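{- Let $k>0$ be an integer and $T$ a tournament with a median ordering, and suppose an interval of this ordering is split into consecutive subintervals $A_1\prec\cdots\prec A_t$ of size $m\ge 2^{20k}$ each. Suppose $F$ is a set of vertices with $|F\cap A_i|\le m/8$ for every $i\in[t]$, and $X\subseteq A_1\setminus F$ is a set of size $8k$ inducing a transitive tournament. Then there are sets $X_1\Rightarrow X_2\Rightarrow\cdots\Rightarrow X_s$ such that $X_1\subseteq X$, and each $X_i$ induces a transitive tournament on $k$ vertices contained in $A_{j_i}\setminus F$, where the indices $1=j_1<\dots<j_s$ satisfy $j_{i+1}\in\{j_i+1,j_i+2\}$ for every $i$, and $j_s\in\{t-1,t\}$.
   Context: A tournament is a complete graph with every edge oriented; it is transitive if its vertices can be ordered so that all edges go from earlier to later vertices. A median ordering of a tournament is an ordering $v_1\prec\dots\prec v_n$ of its vertices maximizing the number of edges oriented $v_i\to v_j$ with $i<j$. An interval is a set of consecutive vertices in this ordering; $X\prec Y$ means $x\prec y$ for all $x\in X,y\in Y$. We write $A\Rightarrow B$ if $A$ and $B$ are disjoint and every vertex of $A$ has an edge oriented to every vertex of $B$. -}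

module Defs where

open import Data.Nat using (ℕ; zero; suc; _+_; _*_; _∸_; _^_; _≤_; _<_)
open import Data.Nat.Properties using (_≤?_; _<?_)
open import Data.Bool using (Bool; true; false; not; _∧_; if_then_else_)
open import Data.Fin using (Fin; toℕ)
import Data.Fin.Properties as FinP
open import Data.Fin.Permutation using (Permutation′; _⟨$⟩ʳ_; _⟨$⟩ˡ_)
open import Data.Fin.Subset using (Subset; _∈_)
open import Data.List using (List; map)
open import Data.Nat.ListAction using (sum)
open import Data.List using () renaming (allFin to allFinL)
open import Data.Vec using (tabulate)
open import Data.Product using (Σ; _×_; ∃)
open import Relation.Binary.PropositionalEquality using (_≡_; _≢_)
open import Relation.Nullary.Decidable using (⌊_⌋)

-- A tournament on the vertex set Fin n: adj u v ≡ true means the edge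
-- between u and v is oriented u → v.  Loopless, and every pair of distinct
-- vertices carries exactly one orientation.
record Tournament (n : ℕ) : Set where
  field
    adj    : Fin n → Fin n → Bool
    irrefl : ∀ v → adj v v ≡ false
    orient : ∀ u v → u ≢ v → adj u v ≡ not (adj v u)
open Tournament public

-- An ordering of the vertices is a permutation σ : positions ↔ vertices;
-- σ ⟨$⟩ʳ p is the vertex in position p, σ ⟨$⟩ˡ v is the position of v.
Ordering : ℕ → Set
Ordering n = Permutation′ n

forwardEdges : ∀ {n} → Tournament n → Ordering n → ℕ
forwardEdges {n} T σ =
  sum (map (λ p → sum (map (λ q →
        if ⌊ p FinP.<? q ⌋ ∧ adj T (σ ⟨$⟩ʳ p) (σ ⟨$⟩ʳ q) then 1 else 0)
      (allFinL n))) (allFinL n))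

IsMedianOrdering : ∀ {n} → Tournament n → Ordering n → Set
IsMedianOrdering T σ = ∀ τ → forwardEdges T τ ≤ forwardEdges T σ

_⟶[_]_ : ∀ {n} → Fin n → Tournament n → Fin n → Set
u ⟶[ T ] v = adj T u v ≡ true

-- S induces a transitive tournament: there is an ordering of S (given by a
-- rank function) such that every edge inside S goes from lower to higher rank.
InducesTransitive : ∀ {n} → Tournament n → Subset n → Set
InducesTransitive {n} T S =
  Σ (Fin n → ℕ) λ r → ∀ u v → u ∈ S → v ∈ S → u ⟶[ T ] v → r u < r v

_⇒[_]_ : ∀ {n} → Subset n → Tournament n → Subset n → Set
A ⇒[ T ] B = (∀ v → v ∈ A → v ∈ B → Data.Empty.⊥) ×
             (∀ u v → u ∈ A → v ∈ B → u ⟶[ T ] v)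
  where import Data.Empty

-- The i-th block (i = 1,2,…) of size m of the interval starting at position a:
-- the vertices whose position p satisfies a + (i-1)m ≤ p < a + i m.
block : ∀ {n} → Ordering n → (a m i : ℕ) → Subset n
block σ a m i = tabulate λ v →
  ⌊ a + (i ∸ 1) * m ≤? toℕ (σ ⟨$⟩ˡ v) ⌋ ∧ ⌊ toℕ (σ ⟨$⟩ˡ v) <? a + i * m ⌋

-- A median ordering has the feedback property: a vertex beats at least half of every interval
-- starting right after it, for otherwise moving it to the end of the interval would create
-- more forward edges.  Since F is sparse, every vertex of block j therefore beats at least m/4
-- vertices of W = (A_{j+1} ∪ A_{j+2}) ∖ F.  Double counting the edges from a transitive set
-- Y ⊆ A_j ∖ F of size 8k into W shows that at least m/(4k) vertices of W have k in-neighbours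
-- in Y.  Splitting these according to the out-neighbourhood of one vertex of Y after another and
-- keeping the larger part, we find k vertices of Y dominating a 2^{-8k}-fraction of them, half of
-- which lie in a single block.  As m ≥ 2^{20k} this leaves 2^{8k} vertices, among which the
-- Erdős–Moser argument finds the next transitive set of size 8k.  Iterating from X gives the chain.

module Submission where

open import Defs
open import Data.Nat using (ℕ; zero; suc; _+_; _*_; _∸_; _^_; _≤_; _<_; z≤n; s≤s)
open import Data.Nat.Properties
open import Data.Nat.Tactic.RingSolver using (solve-∀)
open import Data.Bool using (Bool; true; false; not; _∧_; _∨_; if_then_else_)
open import Data.Bool.Properties
  using (∧-conicalˡ; ∧-conicalʳ; ∧-assoc; ∧-comm; ∧-zeroʳ; ∧-identityʳ; ∨-identityʳ; ∧-distribˡ-∨; not-injective)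
open import Data.Fin using (Fin; zero; suc; toℕ; fromℕ<; punchIn; punchOut)
import Data.Fin.Properties as Fin
open import Data.Product using (Σ; _×_; ∃; ∃₂; _,_)
open import Data.Sum using (_⊎_; inj₁; inj₂; [_,_]′)
open import Data.Empty using (⊥-elim)
open import Function using (id; _∘_; case_of_)
import Data.List as List
import Data.List.Properties as List
import Data.Nat.ListAction as ListAction
open import Data.Vec using ([]; _∷_; lookup; tabulate)
open import Data.Vec.Properties using (lookup∘tabulate; lookup-zipWith; []=⇒lookup; lookup⇒[]=)
open import Data.Fin.Subset using (Subset; _⊆_; _∩_; _─_; ∣_∣; _∈_)
open import Relation.Binary.PropositionalEquality
open import Relation.Nullary using (¬_; Dec; yes; no; contradiction)
open import Relation.Nullary.Decidable using (⌊_⌋)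
open import Relation.Binary.Definitions using (tri<; tri≈; tri>)
open import Data.Fin.Permutation using (Permutation; Permutation′; _⟨$⟩ʳ_; _⟨$⟩ˡ_; _∘ₚ_; inverseˡ; inverseʳ)
import Data.Fin.Permutation as Perm
open import Algebra.Properties.Semiring.Sum +-*-semiring
  using (sum; sum-syntax; sum-cong-≗; sum-replicate-zero; ∑-distrib-+; ∑-comm; ∑-permute; *-distribˡ-sum)

-- ⌊_⌋ (that is, isYes) does not reduce on an undetermined decision, so it is evaluated by these lemmas.
isYes-true : ∀ {A : Set} (a? : Dec A) → A → ⌊ a? ⌋ ≡ true
isYes-true (yes _) _ = refl
isYes-true (no ¬a) a = contradiction a ¬a

isYes-false : ∀ {A : Set} (a? : Dec A) → ¬ A → ⌊ a? ⌋ ≡ false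
isYes-false (no _)  _  = refl
isYes-false (yes a) ¬a = contradiction a ¬a

isYes-sound : ∀ {A : Set} (a? : Dec A) → ⌊ a? ⌋ ≡ true → A
isYes-sound (yes a) _ = a

isYes-⇔ : ∀ {A B : Set} (a? : Dec A) (b? : Dec B) → (A → B) → (B → A) → ⌊ a? ⌋ ≡ ⌊ b? ⌋
isYes-⇔ (yes _) (yes _) _   _   = refl
isYes-⇔ (no _)  (no _)  _   _   = refl
isYes-⇔ (yes a) (no ¬b) a⇒b _   = contradiction (a⇒b a) ¬b
isYes-⇔ (no ¬a) (yes b) _   b⇒a = contradiction (b⇒a b) ¬a

∧-exchange : ∀ a b c → a ∧ (b ∧ c) ≡ b ∧ (a ∧ c)
∧-exchange false b c = sym (∧-zeroʳ b)
∧-exchange true  b c = refl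

-- Counting

indicator : Bool → ℕ
indicator b = if b then 1 else 0

count : ∀ {n} → (Fin n → Bool) → ℕ
count {n} P = ∑[ i < n ] indicator (P i)

_⊆ᵇ_ : ∀ {n} → (Fin n → Bool) → (Fin n → Bool) → Set
P ⊆ᵇ Q = ∀ x → P x ≡ true → Q x ≡ true

∑-mono-≤ : ∀ {n} {f g : Fin n → ℕ} → (∀ i → f i ≤ g i) → sum f ≤ sum g
∑-mono-≤ {zero}  _   = z≤n
∑-mono-≤ {suc n} f≤g = +-mono-≤ (f≤g zero) (∑-mono-≤ (f≤g ∘ suc))

count-false : ∀ n → count {n} (λ _ → false) ≡ 0
count-false n = sum-replicate-zero n

module _ {n : ℕ} where

  count-cong : {P Q : Fin n → Bool} → (∀ x → P x ≡ Q x) → count P ≡ count Q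
  count-cong P≗Q = sum-cong-≗ (cong indicator ∘ P≗Q)

  count-mono : {P Q : Fin n → Bool} → P ⊆ᵇ Q → count P ≤ count Q
  count-mono P⊆Q = ∑-mono-≤ (λ x → indicator-mono (P⊆Q x))
    where
    indicator-mono : ∀ {a b} → (a ≡ true → b ≡ true) → indicator a ≤ indicator b
    indicator-mono {false} _   = z≤n
    indicator-mono {true}  a⇒b rewrite a⇒b refl = ≤-refl

  count-∨ : (P Q : Fin n → Bool) → count (λ x → P x ∨ Q x) ≤ count P + count Q
  count-∨ P Q = begin
    count (λ x → P x ∨ Q x)                 ≤⟨ ∑-mono-≤ (λ x → indicator-∨ (P x) (Q x)) ⟩
    ∑[ x < n ] (indicator (P x) + indicator (Q x)) ≡⟨ ∑-distrib-+ (indicator ∘ P) (indicator ∘ Q) ⟩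
    count P + count Q                       ∎
    where
    open ≤-Reasoning
    indicator-∨ : ∀ a b → indicator (a ∨ b) ≤ indicator a + indicator b
    indicator-∨ false b = ≤-refl
    indicator-∨ true  b = s≤s z≤n

  count-split : (Q P : Fin n → Bool) →
                count P ≡ count (λ x → Q x ∧ P x) + count (λ x → not (Q x) ∧ P x)
  count-split Q P = trans (sum-cong-≗ (λ x → indicator-split (Q x) (P x)))
                          (∑-distrib-+ (λ x → indicator (Q x ∧ P x)) (λ x → indicator (not (Q x) ∧ P x)))
    where
    indicator-split : ∀ a b → indicator b ≡ indicator (a ∧ b) + indicator (not a ∧ b)
    indicator-split false b = refl
    indicator-split true  b = sym (+-identityʳ _)

count-witness : ∀ {n} (P : Fin n → Bool) → 0 < count P → ∃ λ x → P x ≡ true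
count-witness {suc n} P pos with P zero in P0
... | true  = zero , P0
... | false = let x , Px = count-witness (P ∘ suc) pos in suc x , Px

-- Unlike ⌊ u Fin.≟ v ⌋, this reduces on successors.
_==_ : ∀ {n} → Fin n → Fin n → Bool
zero  == zero  = true
zero  == suc _ = false
suc _ == zero  = false
suc u == suc v = u == v

==-refl : ∀ {n} (v : Fin n) → (v == v) ≡ true
==-refl zero    = refl
==-refl (suc v) = ==-refl v

==⇒≡ : ∀ {n} {u v : Fin n} → (u == v) ≡ true → u ≡ v
==⇒≡ {u = zero}  {zero}  _ = refl
==⇒≡ {u = suc u} {suc v} h = cong suc (==⇒≡ h)

≢⇒==-false : ∀ {n} {u v : Fin n} → u ≢ v → (u == v) ≡ false
≢⇒==-false {u = zero}  {zero}  u≢v = contradiction refl u≢v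
≢⇒==-false {u = zero}  {suc v} _   = refl
≢⇒==-false {u = suc u} {zero}  _   = refl
≢⇒==-false {u = suc u} {suc v} u≢v = ≢⇒==-false (u≢v ∘ cong suc)

insert : ∀ {n} → Fin n → (Fin n → Bool) → Fin n → Bool
insert v P u = (u == v) ∨ P u

delete : ∀ {n} → Fin n → (Fin n → Bool) → Fin n → Bool
delete v P u = not (u == v) ∧ P u

count-at : ∀ {n} (v : Fin n) (P : Fin n → Bool) → count (λ u → (u == v) ∧ P u) ≡ indicator (P v)
count-at {suc n} zero    P = trans (cong (indicator (P zero) +_) (count-false n)) (+-identityʳ _)
count-at {suc n} (suc v) P = count-at v (P ∘ suc)

count-remove : ∀ {n} (v : Fin n) (P : Fin n → Bool) → count P ≡ indicator (P v) + count (delete v P)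
count-remove v P = trans (count-split (_== v) P) (cong (_+ count (delete v P)) (count-at v P))

count-delete : ∀ {n} {v : Fin n} (P : Fin n → Bool) → P v ≡ true → count P ≡ suc (count (delete v P))
count-delete {v = v} P Pv = trans (count-remove v P) (cong (λ b → indicator b + count (delete v P)) Pv)

count-insert : ∀ {n} {v : Fin n} (P : Fin n → Bool) → P v ≡ false → count (insert v P) ≡ suc (count P)
count-insert {v = v} P Pv = begin
  count (insert v P)                  ≡⟨ count-delete (insert v P) (cong (_∨ P v) (==-refl v)) ⟩
  suc (count (delete v (insert v P))) ≡⟨ cong suc (count-cong (λ u → not∧∨ (u == v) (P u))) ⟩
  suc (count (delete v P))            ≡⟨ cong (λ b → suc (indicator b + count (delete v P))) Pv ⟨
  suc (indicator (P v) + count (delete v P)) ≡⟨ cong suc (count-remove v P) ⟨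
  suc (count P)                       ∎
  where
  open ≡-Reasoning
  not∧∨ : ∀ a b → not a ∧ (a ∨ b) ≡ not a ∧ b
  not∧∨ false b = refl
  not∧∨ true  b = refl

delete-mono : ∀ {n} {v : Fin n} {P Q : Fin n → Bool} → P ⊆ᵇ Q → delete v P ⊆ᵇ delete v Q
delete-mono {v = v} P⊆Q u with u == v
... | true  = λ ()
... | false = P⊆Q u

count-strict : ∀ {n} {P Q : Fin n → Bool} {x : Fin n} →
               P ⊆ᵇ Q → Q x ≡ true → P x ≡ false → count P < count Q
count-strict {P = P} {Q} {x} P⊆Q Qx Px = begin-strict
  count P                  ≡⟨ count-remove x P ⟩
  indicator (P x) + count (delete x P) ≡⟨ cong (λ b → indicator b + count (delete x P)) Px ⟩
  count (delete x P)       <⟨ s≤s (count-mono (delete-mono P⊆Q)) ⟩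
  suc (count (delete x Q)) ≡⟨ count-delete Q Qx ⟨
  count Q                  ∎
  where open ≤-Reasoning

module _ {n : ℕ} (v : Fin n) (P : Fin n → Bool) where

  delete-⊆ : delete v P ⊆ᵇ P
  delete-⊆ u = ∧-conicalʳ _ _

  delete-absent : delete v P v ≡ false
  delete-absent rewrite ==-refl v = refl

  delete-≢ : ∀ u → delete v P u ≡ true → u ≢ v
  delete-≢ u h refl rewrite ==-refl v = case h of λ ()

  ⊆-delete-absent : {Q : Fin n → Bool} → Q ⊆ᵇ delete v P → Q v ≡ false
  ⊆-delete-absent {Q} Q⊆ with Q v in Qv
  ... | false = refl
  ... | true  = case trans (sym (Q⊆ v Qv)) delete-absent of λ ()

module _ {n : ℕ} {v : Fin n} where

  insert-view : {P : Fin n → Bool} (u : Fin n) → insert v P u ≡ true → u ≡ v ⊎ P u ≡ true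
  insert-view u h with u == v in u=v
  ... | true  = inj₁ (==⇒≡ u=v)
  ... | false = inj₂ h

  insert-⊆ : {P Q : Fin n → Bool} → P v ≡ true → Q ⊆ᵇ P → insert v Q ⊆ᵇ P
  insert-⊆ {Q = Q} Pv Q⊆P u h with insert-view {Q} u h
  ... | inj₁ refl = Pv
  ... | inj₂ Qu   = Q⊆P u Qu

insert-fresh : ∀ {n} {v : Fin n} {S P : Fin n → Bool} → S v ≡ true → P ⊆ᵇ delete v S →
               insert v P ⊆ᵇ S × count (insert v P) ≡ suc (count P)
insert-fresh {v = v} {S} {P} Sv P⊆ =
  insert-⊆ Sv (λ u → delete-⊆ v S u ∘ P⊆ u) , count-insert P (⊆-delete-absent v S P⊆)

count-supported : ∀ {n} (v : Fin n) (P : Fin n → Bool) → (∀ u → u ≢ v → P u ≡ false) → count P ≡ indicator (P v)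
count-supported {n} v P off = begin
  count P                              ≡⟨ count-remove v P ⟩
  indicator (P v) + count (delete v P) ≡⟨ cong (indicator (P v) +_) (trans (count-cong deleted) (count-false n)) ⟩
  indicator (P v) + 0                  ≡⟨ +-identityʳ _ ⟩
  indicator (P v)                      ∎
  where
  open ≡-Reasoning
  deleted : ∀ u → delete v P u ≡ false
  deleted u with u == v in u==v
  ... | true  = refl
  ... | false = off u λ { refl → case trans (sym u==v) (==-refl u) of λ () }

indicator-∧ : ∀ a b → indicator (a ∧ b) ≡ indicator a * indicator b
indicator-∧ false b = refl
indicator-∧ true  b = sym (+-identityʳ (indicator b))

indicator-∧-cong : ∀ a b₁ b₂ b₃ b₄ → indicator b₁ + indicator b₂ ≡ indicator b₃ + indicator b₄ →
                   indicator (a ∧ b₁) + indicator (a ∧ b₂) ≡ indicator (a ∧ b₃) + indicator (a ∧ b₄)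
indicator-∧-cong true  _ _ _ _ eq = eq
indicator-∧-cong false _ _ _ _ _  = refl

subset-of-size : ∀ {n} (P : Fin n → Bool) k → k ≤ count P → ∃ λ Q → Q ⊆ᵇ P × count Q ≡ k
subset-of-size {n} P zero    _       = (λ _ → false) , (λ _ ()) , count-false n
subset-of-size     P (suc k) k<count with count-witness P (≤-trans (s≤s z≤n) k<count)
... | v , Pv with subset-of-size (delete v P) k (≤-pred (subst (suc k ≤_) (count-delete P Pv) k<count))
... | Q , Q⊆ , |Q| = let Q'⊆ , |Q'| = insert-fresh Pv Q⊆ in insert v Q , Q'⊆ , trans |Q'| (cong suc |Q|)

-- Tournaments

module _ {n : ℕ} (T : Tournament n) where

  ⟶-irrefl : ∀ {v} → ¬ (v ⟶[ T ] v)
  ⟶-irrefl {v} h = case trans (sym h) (irrefl T v) of λ ()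

  ⟶-asym : ∀ {u v} → u ⟶[ T ] v → ¬ (v ⟶[ T ] u)
  ⟶-asym {u} {v} uv vu with u Fin.≟ v
  ... | yes refl = ⟶-irrefl uv
  ... | no  u≢v  = case trans (sym uv) (trans (orient T u v u≢v) (cong not vu)) of λ ()

  ⟶-total : ∀ {u v} → u ≢ v → adj T u v ≡ false → v ⟶[ T ] u
  ⟶-total {u} {v} u≢v uv with adj T v u in vu
  ... | true  = refl
  ... | false = case trans (sym uv) (trans (orient T u v u≢v) (cong not vu)) of λ ()

reverse : ∀ {n} → Tournament n → Tournament n
reverse T = record
  { adj    = λ u v → adj T v u
  ; irrefl = irrefl T
  ; orient = λ u v u≢v → orient T v u (u≢v ∘ sym)
  }

_⇒ᵇ[_]_ : ∀ {n} → (Fin n → Bool) → Tournament n → (Fin n → Bool) → Set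
P ⇒ᵇ[ T ] Q = ∀ u v → P u ≡ true → Q v ≡ true → u ⟶[ T ] v

out-neighbours in-neighbours : ∀ {n} → Tournament n → Fin n → (Fin n → Bool) → Fin n → Bool
out-neighbours T v S u = adj T v u ∧ S u
in-neighbours  T v S u = not (adj T v u) ∧ S u

module _ {n : ℕ} (T : Tournament n) (v : Fin n) (S : Fin n → Bool) where

  out-neighbours-⊆ : out-neighbours T v S ⊆ᵇ S
  out-neighbours-⊆ u = ∧-conicalʳ (adj T v u) (S u)

  in-neighbours-⊆ : in-neighbours T v S ⊆ᵇ S
  in-neighbours-⊆ u = ∧-conicalʳ (not (adj T v u)) (S u)

  out-neighbours-⟶ : ∀ u → out-neighbours T v S u ≡ true → v ⟶[ T ] u
  out-neighbours-⟶ u = ∧-conicalˡ (adj T v u) (S u)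

  in-neighbours-⟶ : ∀ u → u ≢ v → in-neighbours T v S u ≡ true → u ⟶[ T ] v
  in-neighbours-⟶ u u≢v h = ⟶-total T (u≢v ∘ sym) (not-injective (∧-conicalˡ (not (adj T v u)) (S u) h))

  count-neighbours : count S ≡ count (out-neighbours T v S) + count (in-neighbours T v S)
  count-neighbours = count-split (adj T v) S

indegree : ∀ {n} → Tournament n → (Fin n → Bool) → Fin n → ℕ
indegree T Y z = count (λ y → Y y ∧ adj T y z)

indegree-≤ : ∀ {n} (T : Tournament n) (Y : Fin n → Bool) z → indegree T Y z ≤ count Y
indegree-≤ T Y z = count-mono (λ y → ∧-conicalˡ (Y y) (adj T y z))

indegree-delete : ∀ {n} (T : Tournament n) {Y : Fin n → Bool} {y} → Y y ≡ true →
                  ∀ z → indegree T Y z ≡ indicator (adj T y z) + indegree T (delete y Y) z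
indegree-delete T {Y} {y} Yy z = trans (count-remove y (λ u → Y u ∧ adj T u z))
  (cong₂ _+_ (cong (λ b → indicator (b ∧ adj T y z)) Yy)
             (count-cong (λ u → sym (∧-assoc (not (u == y)) (Y u) (adj T u z)))))

double-count : ∀ {n} (T : Tournament n) (Y W : Fin n → Bool) →
  ∑[ y < n ] (indicator (Y y) * count (out-neighbours T y W)) ≡ ∑[ z < n ] (indicator (W z) * indegree T Y z)
double-count {n} T Y W = begin
  ∑[ y < n ] (indicator (Y y) * count (out-neighbours T y W))
    ≡⟨ sum-cong-≗ (λ y → *-distribˡ-sum (indicator (Y y)) (λ z → indicator (adj T y z ∧ W z))) ⟩
  ∑[ y < n ] ∑[ z < n ] (indicator (Y y) * indicator (adj T y z ∧ W z))
    ≡⟨ ∑-comm (λ y z → indicator (Y y) * indicator (adj T y z ∧ W z)) ⟩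
  ∑[ z < n ] ∑[ y < n ] (indicator (Y y) * indicator (adj T y z ∧ W z))
    ≡⟨ sum-cong-≗ (λ z → sum-cong-≗ λ y → swap (Y y) (adj T y z) (W z)) ⟩
  ∑[ z < n ] ∑[ y < n ] (indicator (W z) * indicator (Y y ∧ adj T y z))
    ≡⟨ sum-cong-≗ (λ z → *-distribˡ-sum (indicator (W z)) (λ y → indicator (Y y ∧ adj T y z))) ⟨
  ∑[ z < n ] (indicator (W z) * indegree T Y z) ∎
  where
  open ≡-Reasoning
  swap : ∀ a b c → indicator a * indicator (b ∧ c) ≡ indicator c * indicator (a ∧ b)
  swap a b c = begin
    indicator a * indicator (b ∧ c)             ≡⟨ cong (indicator a *_) (indicator-∧ b c) ⟩
    indicator a * (indicator b * indicator c)   ≡⟨ rearrange (indicator a) (indicator b) (indicator c) ⟩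
    indicator c * (indicator a * indicator b)   ≡⟨ cong (indicator c *_) (indicator-∧ a b) ⟨
    indicator c * indicator (a ∧ b)             ∎
    where
    rearrange : ∀ x y z → x * (y * z) ≡ z * (x * y)
    rearrange = solve-∀

TransitiveOn : ∀ {n} → Tournament n → (Fin n → Bool) → Set
TransitiveOn T P = ∀ u v w → P u ≡ true → P v ≡ true → P w ≡ true →
                   u ⟶[ T ] v → v ⟶[ T ] w → u ⟶[ T ] w

InducesTransitiveᵇ : ∀ {n} → Tournament n → (Fin n → Bool) → Set
InducesTransitiveᵇ {n} T P = Σ (Fin n → ℕ) λ r → ∀ u v → P u ≡ true → P v ≡ true → u ⟶[ T ] v → r u < r v

transitive-reverse : ∀ {n} (T : Tournament n) {P : Fin n → Bool} → TransitiveOn T P → TransitiveOn (reverse T) P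
transitive-reverse T tr u v w Pu Pv Pw vu wv = tr w v u Pw Pv Pu wv vu

transitive-insert-source : ∀ {n} (T : Tournament n) {P : Fin n → Bool} {v} → TransitiveOn T P →
                           (∀ u → P u ≡ true → v ⟶[ T ] u) → TransitiveOn T (insert v P)
transitive-insert-source T {P} tr out u w z hu hw hz uw wz
  with insert-view {P = P} u hu | insert-view {P = P} w hw | insert-view {P = P} z hz
... | _         | inj₁ refl | inj₁ refl = ⊥-elim (⟶-irrefl T wz)
... | inj₁ refl | inj₁ refl | _         = ⊥-elim (⟶-irrefl T uw)
... | inj₁ refl | inj₂ Pw   | inj₁ refl = ⊥-elim (⟶-asym T uw wz)
... | inj₁ refl | _         | inj₂ Pz   = out z Pz
... | inj₂ Pu   | inj₁ refl | _         = ⊥-elim (⟶-asym T uw (out u Pu))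
... | inj₂ Pu   | inj₂ Pw   | inj₁ refl = ⊥-elim (⟶-asym T wz (out w Pw))
... | inj₂ Pu   | inj₂ Pw   | inj₂ Pz   = tr u w z Pu Pw Pz uw wz

transitive-insert-sink : ∀ {n} (T : Tournament n) {P : Fin n → Bool} {v} → TransitiveOn T P →
                         (∀ u → P u ≡ true → u ⟶[ T ] v) → TransitiveOn T (insert v P)
transitive-insert-sink T tr into =
  transitive-reverse (reverse T) (transitive-insert-source (reverse T) (transitive-reverse T tr) into)

transitive⇒ranked : ∀ {n} (T : Tournament n) {P : Fin n → Bool} → TransitiveOn T P → InducesTransitiveᵇ T P
transitive⇒ranked T {P} tr = indegree T P , increasing
  where
  increasing : ∀ u v → P u ≡ true → P v ≡ true → u ⟶[ T ] v → indegree T P u < indegree T P v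
  increasing u v Pu Pv uv = count-strict into-u⊆into-v
    (trans (cong (_∧ adj T u v) Pu) uv) (trans (cong (_∧ adj T u u) Pu) (irrefl T u))
    where
    into-u⊆into-v : (λ w → P w ∧ adj T w u) ⊆ᵇ (λ w → P w ∧ adj T w v)
    into-u⊆into-v w h = trans (cong (_∧ adj T w v) (∧-conicalˡ _ _ h))
                              (tr w u v (∧-conicalˡ _ _ h) Pu Pv (∧-conicalʳ _ _ h) uv)

ranked-⊆ : ∀ {n} (T : Tournament n) {P Q : Fin n → Bool} → Q ⊆ᵇ P → InducesTransitiveᵇ T P → InducesTransitiveᵇ T Q
ranked-⊆ T Q⊆P (r , increasing) = r , λ u v Qu Qv → increasing u v (Q⊆P u Qu) (Q⊆P v Qv)

erdős-moser : ∀ {n} (T : Tournament n) r (S : Fin n → Bool) → 2 ^ r ≤ count S →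
              ∃ λ P → P ⊆ᵇ S × count P ≡ r × TransitiveOn T P
erdős-moser {n} T zero    S _   = (λ _ → false) , (λ _ ()) , count-false n , λ _ _ _ ()
erdős-moser {n} T (suc r) S big with count-witness S (≤-trans (m^n>0 2 (suc r)) big)
... | v , Sv with 2 ^ r ≤? count (out-neighbours T v (delete v S))
... | yes bigOut =
  let P , P⊆Out , |P| , trP = erdős-moser T r _ bigOut
      P'⊆ , |P'| = insert-fresh Sv (λ u → out-neighbours-⊆ T v (delete v S) u ∘ P⊆Out u)
  in insert v P , P'⊆ , trans |P'| (cong suc |P|) ,
     transitive-insert-source T trP (λ u → out-neighbours-⟶ T v (delete v S) u ∘ P⊆Out u)
... | no smallOut =
  let P , P⊆In , |P| , trP = erdős-moser T r In bigIn
      P⊆S-v : P ⊆ᵇ delete v S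
      P⊆S-v u = in-neighbours-⊆ T v (delete v S) u ∘ P⊆In u
      P'⊆ , |P'| = insert-fresh Sv P⊆S-v
  in insert v P , P'⊆ , trans |P'| (cong suc |P|) ,
     transitive-insert-sink T trP (λ u Pu → in-neighbours-⟶ T v (delete v S) u
                                              (delete-≢ v S u (P⊆S-v u Pu)) (P⊆In u Pu))
  where
  In : Fin n → Bool
  In = in-neighbours T v (delete v S)
  bigIn : 2 ^ r ≤ count In
  bigIn = +-cancelˡ-≤ (2 ^ r) _ _ (begin
    2 ^ r + 2 ^ r                   ≡⟨ cong (2 ^ r +_) (+-identityʳ (2 ^ r)) ⟨
    2 ^ suc r                       ≤⟨ big ⟩
    count S                         ≡⟨ count-delete S Sv ⟩
    suc (count (delete v S))        ≡⟨ cong suc (count-neighbours T v (delete v S)) ⟩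
    suc (count (out-neighbours T v (delete v S))) + count In
                                    ≤⟨ +-monoˡ-≤ (count In) (≰⇒> smallOut) ⟩
    2 ^ r + count In                ∎)
    where open ≤-Reasoning

insert-⇒ : ∀ {n} (T : Tournament n) {y : Fin n} {P Q : Fin n → Bool} →
           (∀ z → Q z ≡ true → y ⟶[ T ] z) → P ⇒ᵇ[ T ] Q → insert y P ⇒ᵇ[ T ] Q
insert-⇒ T {P = P} y⇒Q P⇒Q u z hu hz with insert-view {P = P} u hu
... | inj₁ refl = y⇒Q z hz
... | inj₂ Pu   = P⇒Q u z Pu hz

n≤m⇒m+n≤2*m : ∀ {m n} → n ≤ m → m + n ≤ 2 * m
n≤m⇒m+n≤2*m {m} n≤m = +-monoʳ-≤ m (≤-trans n≤m (≤-reflexive (sym (+-identityʳ m))))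

CommonOutNeighbourhood : ∀ {n} → Tournament n → (Y Z : Fin n → Bool) (c L : ℕ) → Set
CommonOutNeighbourhood T Y Z c L = ∃₂ λ Y' Z' →
  Y' ⊆ᵇ Y × count Y' ≡ c × Z' ⊆ᵇ Z × Y' ⇒ᵇ[ T ] Z' × count Z ≤ 2 ^ L * count Z'

-- Pick y ∈ Y, split Z by whether y beats it, and recurse into the larger part.
common-out-neighbourhood : ∀ {n} (T : Tournament n) L (Y : Fin n → Bool) → count Y ≡ L →
  ∀ c → c ≤ L → (Z : Fin n → Bool) → (∀ z → Z z ≡ true → c ≤ indegree T Y z) →
  CommonOutNeighbourhood T Y Z c L
common-out-neighbourhood {n} T L Y _ zero _ Z _ =
  (λ _ → false) , Z , (λ _ ()) , count-false n , (λ _ h → h) , (λ _ _ ()) ,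
  m≤n*m (count Z) (2 ^ L) {{m^n≢0 2 L}}
common-out-neighbourhood T zero Y _ (suc c) () Z _
common-out-neighbourhood {n} T (suc L) Y |Y| (suc c) c<L Z many
  with count-witness Y (subst (0 <_) (sym |Y|) (s≤s z≤n))
... | y , Yy = pick (count Zin ≤? count Zout)
  where
  Y₁ Zout Zin : Fin n → Bool
  Y₁   = delete y Y
  Zout = out-neighbours T y Z
  Zin  = in-neighbours T y Z
  |Y₁| : count Y₁ ≡ L
  |Y₁| = suc-injective (trans (sym (count-delete Y Yy)) |Y|)
  many-out : ∀ z → Zout z ≡ true → c ≤ indegree T Y₁ z
  many-out z h = ≤-pred (subst (suc c ≤_)
    (trans (indegree-delete T Yy z) (cong (λ b → indicator b + indegree T Y₁ z) (out-neighbours-⟶ T y Z z h)))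
    (many z (out-neighbours-⊆ T y Z z h)))
  many-in : ∀ z → Zin z ≡ true → suc c ≤ indegree T Y₁ z
  many-in z h = subst (suc c ≤_)
    (trans (indegree-delete T Yy z) (cong (λ b → indicator b + indegree T Y₁ z) (not-injective (∧-conicalˡ _ (Z z) h))))
    (many z (in-neighbours-⊆ T y Z z h))
  larger-part : ∀ p → count Z ≤ 2 * p → ∀ Z' → p ≤ 2 ^ L * count Z' → count Z ≤ 2 ^ suc L * count Z'
  larger-part p Z≤2P Z' P≤ = ≤-trans Z≤2P (≤-trans (*-monoʳ-≤ 2 P≤) (≤-reflexive (sym (*-assoc 2 (2 ^ L) (count Z')))))
  pick : Dec (count Zin ≤ count Zout) → CommonOutNeighbourhood T Y Z (suc c) (suc L)
  pick (yes in≤out) =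
    let Y'' , Z' , Y''⊆ , |Y''| , Z'⊆ , Y''⇒Z' , large = common-out-neighbourhood T L Y₁ |Y₁| c (≤-pred c<L) Zout many-out
        Y'⊆ , |Y'| = insert-fresh Yy Y''⊆
    in insert y Y'' , Z' , Y'⊆ , trans |Y'| (cong suc |Y''|) , (λ z → out-neighbours-⊆ T y Z z ∘ Z'⊆ z) ,
       insert-⇒ T (λ z → out-neighbours-⟶ T y Z z ∘ Z'⊆ z) Y''⇒Z' ,
       larger-part (count Zout) (≤-trans (≤-reflexive (count-neighbours T y Z)) (n≤m⇒m+n≤2*m in≤out)) Z' large
  pick (no in≰out) =
    let z₀ , Zin-z₀ = count-witness Zin (≤-<-trans z≤n (≰⇒> in≰out))
        Y' , Z' , Y'⊆ , |Y'| , Z'⊆ , Y'⇒Z' , large = common-out-neighbourhood T L Y₁ |Y₁| (suc c)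
          (≤-trans (many-in z₀ Zin-z₀) (subst (indegree T Y₁ z₀ ≤_) |Y₁| (indegree-≤ T Y₁ z₀))) Zin many-in
    in Y' , Z' , (λ u → delete-⊆ y Y u ∘ Y'⊆ u) , |Y'| , (λ z → in-neighbours-⊆ T y Z z ∘ Z'⊆ z) , Y'⇒Z' ,
       larger-part (count Zin) (≤-trans (≤-reflexive (trans (count-neighbours T y Z) (+-comm (count Zout) (count Zin))))
                                        (n≤m⇒m+n≤2*m (<⇒≤ (≰⇒> in≰out)))) Z' large

-- Median orderings

inRange : ℕ → ℕ → ℕ → Bool
inRange lo hi x = ⌊ lo ≤? x ⌋ ∧ ⌊ x <? hi ⌋

inRange-lo : ∀ {lo hi x} → inRange lo hi x ≡ true → lo ≤ x
inRange-lo {lo} {hi} {x} h = isYes-sound (lo ≤? x) (∧-conicalˡ _ _ h)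

inRange-hi : ∀ {lo hi x} → inRange lo hi x ≡ true → x < hi
inRange-hi {lo} {hi} {x} h = isYes-sound (x <? hi) (∧-conicalʳ ⌊ lo ≤? x ⌋ _ h)

inRange-suc : ∀ lo hi x → inRange (suc lo) (suc hi) (suc x) ≡ inRange lo hi x
inRange-suc lo hi x = cong₂ _∧_ (isYes-⇔ (suc lo ≤? suc x) (lo ≤? x) ≤-pred s≤s)
                                (isYes-⇔ (suc x <? suc hi) (x <? hi) ≤-pred s≤s)

inRange-split : ∀ {lo mid hi} → lo ≤ mid → mid ≤ hi → ∀ x → inRange lo hi x ≡ inRange lo mid x ∨ inRange mid hi x
inRange-split {lo} {mid} {hi} lo≤mid mid≤hi x with x <? mid
... | yes x<mid = begin
  ⌊ lo ≤? x ⌋ ∧ ⌊ x <? hi ⌋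
    ≡⟨ cong (⌊ lo ≤? x ⌋ ∧_) (isYes-true (x <? hi) (<-≤-trans x<mid mid≤hi)) ⟩
  ⌊ lo ≤? x ⌋ ∧ true
    ≡⟨ ∨-identityʳ _ ⟨
  (⌊ lo ≤? x ⌋ ∧ true) ∨ false
    ≡⟨ cong ((⌊ lo ≤? x ⌋ ∧ true) ∨_) (cong (_∧ ⌊ x <? hi ⌋) (isYes-false (mid ≤? x) (<⇒≱ x<mid))) ⟨
  (⌊ lo ≤? x ⌋ ∧ true) ∨ (⌊ mid ≤? x ⌋ ∧ ⌊ x <? hi ⌋) ∎
  where open ≡-Reasoning
... | no x≮mid = begin
  ⌊ lo ≤? x ⌋ ∧ ⌊ x <? hi ⌋
    ≡⟨ cong (_∧ ⌊ x <? hi ⌋) (isYes-true (lo ≤? x) (≤-trans lo≤mid (≮⇒≥ x≮mid))) ⟩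
  ⌊ x <? hi ⌋
    ≡⟨ cong (_∧ ⌊ x <? hi ⌋) (isYes-true (mid ≤? x) (≮⇒≥ x≮mid)) ⟨
  ⌊ mid ≤? x ⌋ ∧ ⌊ x <? hi ⌋
    ≡⟨ cong (_∨ (⌊ mid ≤? x ⌋ ∧ ⌊ x <? hi ⌋)) (∧-zeroʳ ⌊ lo ≤? x ⌋) ⟨
  (⌊ lo ≤? x ⌋ ∧ false) ∨ (⌊ mid ≤? x ⌋ ∧ ⌊ x <? hi ⌋) ∎
  where open ≡-Reasoning

pos : ∀ {n} → Ordering n → Fin n → ℕ
pos σ v = toℕ (σ ⟨$⟩ˡ v)

count-by-position : ∀ {n} (σ : Ordering n) (P : ℕ → Fin n → Bool) →
                    count (λ v → P (pos σ v) v) ≡ ∑[ x < n ] indicator (P (toℕ x) (σ ⟨$⟩ʳ x))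
count-by-position σ P = trans (∑-permute (λ v → indicator (P (pos σ v) v)) σ)
  (sum-cong-≗ λ x → cong (λ u → indicator (P (toℕ u) (σ ⟨$⟩ʳ x))) (inverseˡ σ {x}))

count-range : ∀ n lo hi → hi ≤ n → count {n} (λ x → inRange lo hi (toℕ x)) ≡ hi ∸ lo
count-range n lo zero _ = begin
  count {n} (λ x → inRange lo 0 (toℕ x)) ≡⟨ count-cong {n} (λ x → ∧-zeroʳ ⌊ lo ≤? toℕ x ⌋) ⟩
  count {n} (λ _ → false)            ≡⟨ count-false n ⟩
  0                                  ≡⟨ 0∸n≡0 lo ⟨
  0 ∸ lo                             ∎
  where open ≡-Reasoning
count-range (suc n) zero (suc hi) (s≤s hi≤n) = cong suc (begin
  count {n} (λ x → inRange 0 (suc hi) (suc (toℕ x)))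
    ≡⟨ count-cong {n} (λ x → isYes-⇔ (suc (toℕ x) <? suc hi) (toℕ x <? hi) ≤-pred s≤s) ⟩
  count {n} (λ x → inRange 0 hi (toℕ x))
    ≡⟨ count-range n 0 hi hi≤n ⟩
  hi ∎)
  where open ≡-Reasoning
count-range (suc n) (suc lo) (suc hi) (s≤s hi≤n) = begin
  count {n} (λ x → inRange (suc lo) (suc hi) (suc (toℕ x))) ≡⟨ count-cong {n} (λ x → inRange-suc lo hi (toℕ x)) ⟩
  count {n} (λ x → inRange lo hi (toℕ x))                   ≡⟨ count-range n lo hi hi≤n ⟩
  hi ∸ lo                                                   ∎
  where open ≡-Reasoning

count-positions : ∀ {n} (σ : Ordering n) lo hi → hi ≤ n → count (λ v → inRange lo hi (pos σ v)) ≡ hi ∸ lo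
count-positions {n} σ lo hi hi≤n = trans (count-by-position σ λ x _ → inRange lo hi x) (count-range n lo hi hi≤n)

punchIn-mono-< : ∀ {n} (j : Fin (suc n)) {x y : Fin n} → toℕ x < toℕ y → toℕ (punchIn j x) < toℕ (punchIn j y)
punchIn-mono-< zero    x<y = s≤s x<y
punchIn-mono-< (suc j) {zero}  {suc y} _         = s≤s z≤n
punchIn-mono-< (suc j) {suc x} {suc y} (s≤s x<y) = s≤s (punchIn-mono-< j x<y)

punchOut-mono-< : ∀ {n} {i x y : Fin (suc n)} (i≢x : i ≢ x) (i≢y : i ≢ y) →
                  toℕ x < toℕ y → toℕ (punchOut i≢x) < toℕ (punchOut i≢y)
punchOut-mono-< {i = zero}  {zero}  i≢x _ _ = contradiction refl i≢x
punchOut-mono-< {i = zero}  {suc x} {suc y} _ _ (s≤s x<y) = x<y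
punchOut-mono-< {suc n} {i = suc i} {zero} {suc y} _ _ _ = s≤s z≤n
punchOut-mono-< {suc n} {i = suc i} {suc x} {suc y} i≢x i≢y (s≤s x<y) =
  s≤s (punchOut-mono-< (i≢x ∘ cong suc) (i≢y ∘ cong suc) x<y)

toℕ-punchIn-< : ∀ {n} (j : Fin (suc n)) (x : Fin n) → toℕ x < toℕ j → toℕ (punchIn j x) ≡ toℕ x
toℕ-punchIn-< (suc j) zero    _         = refl
toℕ-punchIn-< (suc j) (suc x) (s≤s x<j) = cong suc (toℕ-punchIn-< j x x<j)

toℕ-punchIn-≥ : ∀ {n} (j : Fin (suc n)) (x : Fin n) → toℕ j ≤ toℕ x → toℕ (punchIn j x) ≡ suc (toℕ x)
toℕ-punchIn-≥ zero    x       _         = refl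
toℕ-punchIn-≥ (suc j) (suc x) (s≤s j≤x) = cong suc (toℕ-punchIn-≥ j x j≤x)

toℕ-punchOut-< : ∀ {n} {i x : Fin (suc n)} (i≢x : i ≢ x) → toℕ x < toℕ i → toℕ (punchOut i≢x) ≡ toℕ x
toℕ-punchOut-< {suc n} {suc i} {zero}  _   _         = refl
toℕ-punchOut-< {suc n} {suc i} {suc x} i≢x (s≤s x<i) = cong suc (toℕ-punchOut-< (i≢x ∘ cong suc) x<i)

toℕ-punchOut-> : ∀ {n} {i x : Fin (suc n)} (i≢x : i ≢ x) → toℕ i < toℕ x → suc (toℕ (punchOut i≢x)) ≡ toℕ x
toℕ-punchOut-> {i = zero}  {suc x} _   _         = refl
toℕ-punchOut-> {suc n} {suc i} {suc x} i≢x (s≤s i<x) = cong suc (toℕ-punchOut-> (i≢x ∘ cong suc) i<x)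

insert-moved : ∀ {m n} (i : Fin (suc m)) (j : Fin (suc n)) (π : Permutation m n) → Perm.insert i j π ⟨$⟩ʳ i ≡ j
insert-moved i j π with i Fin.≟ i
... | yes _  = refl
... | no i≢i = contradiction refl i≢i

insert-unmoved : ∀ {m n} (i : Fin (suc m)) (j : Fin (suc n)) (π : Permutation m n) {k} (i≢k : i ≢ k) →
                 Perm.insert i j π ⟨$⟩ʳ k ≡ punchIn j (π ⟨$⟩ʳ punchOut i≢k)
insert-unmoved i j π i≢k = trans (cong (Perm.insert i j π ⟨$⟩ʳ_) (sym (Fin.punchIn-punchOut i≢k)))
                                 (Perm.insert-punchIn i j π (punchOut i≢k))

-- ρ moves position i to position j, shifting positions i+1, …, j down by one;
-- rank k is the new position of what stood at position k.
module Rotation {n} (i j : Fin (suc n)) (i<j : toℕ i < toℕ j) where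

  ρ : Permutation′ (suc n)
  ρ = Perm.insert i j Perm.id

  rank : Fin (suc n) → ℕ
  rank k = toℕ (ρ ⟨$⟩ʳ k)

  between : Fin (suc n) → Bool
  between k = inRange (suc (toℕ i)) (suc (toℕ j)) (toℕ k)

  data Position (k : Fin (suc n)) : Set where
    before  : toℕ k < toℕ i → Position k
    shifted : toℕ i < toℕ k → toℕ k ≤ toℕ j → Position k
    after   : toℕ j < toℕ k → Position k

  position : ∀ {k} → i ≢ k → Position k
  position {k} i≢k with <-cmp (toℕ k) (toℕ i) | toℕ k ≤? toℕ j
  ... | tri< k<i _ _ | _       = before k<i
  ... | tri≈ _ k≡i _ | _       = contradiction (Fin.toℕ-injective (sym k≡i)) i≢k
  ... | tri> _ _ i<k | yes k≤j = shifted i<k k≤j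
  ... | tri> _ _ i<k | no  k≰j = after (≰⇒> k≰j)

  rank-moved : rank i ≡ toℕ j
  rank-moved = cong toℕ (insert-moved i j Perm.id)

  rank-unmoved : ∀ {k} (i≢k : i ≢ k) → rank k ≡ toℕ (punchIn j (punchOut i≢k))
  rank-unmoved i≢k = cong toℕ (insert-unmoved i j Perm.id i≢k)

  rank-before : ∀ {k} (i≢k : i ≢ k) → toℕ k < toℕ i → rank k ≡ toℕ k
  rank-before {k} i≢k k<i = trans (rank-unmoved i≢k)
    (trans (toℕ-punchIn-< j _ (subst (_< toℕ j) (sym out) (<-trans k<i i<j))) out)
    where
    out : toℕ (punchOut i≢k) ≡ toℕ k
    out = toℕ-punchOut-< i≢k k<i

  rank-shifted : ∀ {k} (i≢k : i ≢ k) → toℕ i < toℕ k → toℕ k ≤ toℕ j → suc (rank k) ≡ toℕ k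
  rank-shifted {k} i≢k i<k k≤j = trans (cong suc (rank-unmoved i≢k))
    (trans (cong suc (toℕ-punchIn-< j _ (subst (_≤ toℕ j) (sym out) k≤j))) out)
    where
    out : suc (toℕ (punchOut i≢k)) ≡ toℕ k
    out = toℕ-punchOut-> i≢k i<k

  rank-after : ∀ {k} (i≢k : i ≢ k) → toℕ j < toℕ k → rank k ≡ toℕ k
  rank-after {k} i≢k j<k = trans (rank-unmoved i≢k)
    (trans (toℕ-punchIn-≥ j _ (≤-pred (subst (toℕ j <_) (sym out) j<k))) out)
    where
    out : suc (toℕ (punchOut i≢k)) ≡ toℕ k
    out = toℕ-punchOut-> i≢k (<-trans i<j j<k)

  rank-mono : ∀ {x y} → i ≢ x → i ≢ y → toℕ x < toℕ y → rank x < rank y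
  rank-mono i≢x i≢y x<y rewrite rank-unmoved i≢x | rank-unmoved i≢y =
    punchIn-mono-< j (punchOut-mono-< i≢x i≢y x<y)

  rank-reflects : ∀ {x y} → i ≢ x → i ≢ y → rank x < rank y → toℕ x < toℕ y
  rank-reflects {x} {y} i≢x i≢y rx<ry with <-cmp (toℕ x) (toℕ y)
  ... | tri< x<y _ _ = x<y
  ... | tri≈ _ x≡y _ rewrite Fin.toℕ-injective x≡y = ⊥-elim (<-irrefl refl rx<ry)
  ... | tri> _ _ y<x = ⊥-elim (<-asym rx<ry (rank-mono i≢y i≢x y<x))

  between-before : ∀ {k} → toℕ k < toℕ i → between k ≡ false
  between-before {k} k<i = cong (_∧ ⌊ toℕ k <? suc (toℕ j) ⌋) (isYes-false (toℕ i <? toℕ k) (<⇒≯ k<i))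

  between-moved : between i ≡ false
  between-moved = cong (_∧ ⌊ toℕ i <? suc (toℕ j) ⌋) (isYes-false (toℕ i <? toℕ i) (<-irrefl refl))

  between-shifted : ∀ {k} → toℕ i < toℕ k → toℕ k ≤ toℕ j → between k ≡ true
  between-shifted {k} i<k k≤j = cong₂ _∧_ (isYes-true (toℕ i <? toℕ k) i<k) (isYes-true (toℕ k <? suc (toℕ j)) (s≤s k≤j))

  between-after : ∀ {k} → toℕ j < toℕ k → between k ≡ false
  between-after {k} j<k = trans (cong (⌊ toℕ i <? toℕ k ⌋ ∧_) (isYes-false (toℕ k <? suc (toℕ j)) (<⇒≱ j<k ∘ ≤-pred)))
                                (∧-zeroʳ _)

  private
    by-values : ∀ {a b c d a′ b′ c′ d′} → a ≡ a′ → b ≡ b′ → c ≡ c′ → d ≡ d′ →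
                indicator a′ + indicator b′ ≡ indicator c′ + indicator d′ →
                indicator a + indicator b ≡ indicator c + indicator d
    by-values refl refl refl refl eq = eq

  -- The only pairs whose relative order ρ changes are i together with a position in (i, j].
  Identity : Fin (suc n) → Fin (suc n) → Set
  Identity x y = indicator ⌊ x Fin.<? y ⌋ + indicator ((y == i) ∧ between x) ≡
                 indicator ⌊ rank x <? rank y ⌋ + indicator ((x == i) ∧ between y)

  identity-moved-both : Identity i i
  identity-moved-both = by-values
    (isYes-false (i Fin.<? i) (<-irrefl refl)) (cong₂ _∧_ (==-refl i) between-moved)
    (isYes-false (rank i <? rank i) (<-irrefl refl)) (cong₂ _∧_ (==-refl i) between-moved) refl

  identity-moved-first : ∀ {y} → i ≢ y → Position y → Identity i y
  identity-moved-first {y} i≢y (before y<i) = by-values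
    (isYes-false (i Fin.<? y) (<⇒≯ y<i)) (cong (_∧ between i) (≢⇒==-false (i≢y ∘ sym)))
    (isYes-false (rank i <? rank y) λ h → <-asym (<-trans y<i i<j) (subst₂ _<_ rank-moved (rank-before i≢y y<i) h))
    (cong₂ _∧_ (==-refl i) (between-before y<i)) refl
  identity-moved-first {y} i≢y (shifted i<y y≤j) = by-values
    (isYes-true (i Fin.<? y) i<y) (cong (_∧ between i) (≢⇒==-false (i≢y ∘ sym)))
    (isYes-false (rank i <? rank y) λ h → <⇒≱ (subst (_< toℕ y) rank-moved (<-trans h (≤-reflexive (rank-shifted i≢y i<y y≤j)))) y≤j)
    (cong₂ _∧_ (==-refl i) (between-shifted i<y y≤j)) refl
  identity-moved-first {y} i≢y (after j<y) = by-values
    (isYes-true (i Fin.<? y) (<-trans i<j j<y)) (cong (_∧ between i) (≢⇒==-false (i≢y ∘ sym)))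
    (isYes-true (rank i <? rank y) (subst₂ _<_ (sym rank-moved) (sym (rank-after i≢y j<y)) j<y))
    (cong₂ _∧_ (==-refl i) (between-after j<y)) refl

  identity-moved-second : ∀ {x} → i ≢ x → Position x → Identity x i
  identity-moved-second {x} i≢x (before x<i) = by-values
    (isYes-true (x Fin.<? i) x<i) (cong₂ _∧_ (==-refl i) (between-before x<i))
    (isYes-true (rank x <? rank i) (subst₂ _<_ (sym (rank-before i≢x x<i)) (sym rank-moved) (<-trans x<i i<j)))
    (cong (_∧ between i) (≢⇒==-false (i≢x ∘ sym))) refl
  identity-moved-second {x} i≢x (shifted i<x x≤j) = by-values
    (isYes-false (x Fin.<? i) (<⇒≯ i<x)) (cong₂ _∧_ (==-refl i) (between-shifted i<x x≤j))
    (isYes-true (rank x <? rank i) (subst (rank x <_) (sym rank-moved) (≤-trans (≤-reflexive (rank-shifted i≢x i<x x≤j)) x≤j)))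
    (cong (_∧ between i) (≢⇒==-false (i≢x ∘ sym))) refl
  identity-moved-second {x} i≢x (after j<x) = by-values
    (isYes-false (x Fin.<? i) (<⇒≯ (<-trans i<j j<x))) (cong₂ _∧_ (==-refl i) (between-after j<x))
    (isYes-false (rank x <? rank i) λ h → <-asym j<x (subst₂ _<_ (rank-after i≢x j<x) rank-moved h))
    (cong (_∧ between i) (≢⇒==-false (i≢x ∘ sym))) refl

  identity-unmoved : ∀ {x y} → i ≢ x → i ≢ y → Identity x y
  identity-unmoved {x} {y} i≢x i≢y = by-values
    (isYes-⇔ (x Fin.<? y) (rank x <? rank y) (rank-mono i≢x i≢y) (rank-reflects i≢x i≢y))
    (cong (_∧ between x) (≢⇒==-false (i≢y ∘ sym)))
    refl (cong (_∧ between y) (≢⇒==-false (i≢x ∘ sym))) refl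

  rotation-identity : ∀ x y → Identity x y
  rotation-identity x y = by-cases x y (i Fin.≟ x) (i Fin.≟ y)
    where
    by-cases : ∀ x y → Dec (i ≡ x) → Dec (i ≡ y) → Identity x y
    by-cases _ _ (yes refl) (yes refl) = identity-moved-both
    by-cases _ _ (yes refl) (no i≢y)   = identity-moved-first i≢y (position i≢y)
    by-cases _ _ (no i≢x)   (yes refl) = identity-moved-second i≢x (position i≢x)
    by-cases _ _ (no i≢x)   (no i≢y)   = identity-unmoved i≢x i≢y

∑-allFin : ∀ n (g : Fin n → ℕ) → ListAction.sum (List.map g (List.allFin n)) ≡ ∑[ i < n ] g i
∑-allFin n g = trans (cong ListAction.sum (List.map-tabulate id g)) (∑-tabulate n g)
  where
  ∑-tabulate : ∀ n (g : Fin n → ℕ) → ListAction.sum (List.tabulate g) ≡ ∑[ i < n ] g i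
  ∑-tabulate zero    g = refl
  ∑-tabulate (suc n) g = cong (g zero +_) (∑-tabulate n (g ∘ suc))

forwardEdges≡∑ : ∀ {n} (T : Tournament n) (σ : Ordering n) →
  forwardEdges T σ ≡ ∑[ p < n ] ∑[ q < n ] indicator (adj T (σ ⟨$⟩ʳ p) (σ ⟨$⟩ʳ q) ∧ ⌊ p Fin.<? q ⌋)
forwardEdges≡∑ {n} T σ = trans (∑-allFin n _) (sum-cong-≗ λ p → trans (∑-allFin n _) (sum-cong-≗ λ q →
  cong indicator (∧-comm ⌊ p Fin.<? q ⌋ (adj T (σ ⟨$⟩ʳ p) (σ ⟨$⟩ʳ q)))))

-- Moving the vertex at position i to position j trades its in-edges from positions (i, j]
-- (forward before the move) for its out-edges to them (forward after it).
module Rotated {n} (T : Tournament (suc n)) (σ : Ordering (suc n)) (i j : Fin (suc n)) (i<j : toℕ i < toℕ j) where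

  open Rotation i j i<j

  edge : Fin (suc n) → Fin (suc n) → Bool
  edge p q = adj T (σ ⟨$⟩ʳ p) (σ ⟨$⟩ʳ q)

  rotated : Ordering (suc n)
  rotated = Perm.flip ρ ∘ₚ σ

  ∑∑ : (Fin (suc n) → Fin (suc n) → ℕ) → ℕ
  ∑∑ f = ∑[ x < suc n ] ∑[ y < suc n ] f x y

  ∑∑-distrib-+ : ∀ (f g : Fin (suc n) → Fin (suc n) → ℕ) → ∑∑ (λ x y → f x y + g x y) ≡ ∑∑ f + ∑∑ g
  ∑∑-distrib-+ f g = trans (sum-cong-≗ λ x → ∑-distrib-+ (f x) (g x)) (∑-distrib-+ (λ x → sum (f x)) (λ x → sum (g x)))

  forward-before forward-after into-term out-term : Fin (suc n) → Fin (suc n) → ℕ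
  forward-before x y = indicator (edge x y ∧ ⌊ x Fin.<? y ⌋)
  forward-after  x y = indicator (edge x y ∧ ⌊ rank x <? rank y ⌋)
  into-term      x y = indicator (edge x y ∧ ((y == i) ∧ between x))
  out-term       x y = indicator (edge x y ∧ ((x == i) ∧ between y))

  forward-rotated : forwardEdges T rotated ≡ ∑∑ forward-after
  forward-rotated = begin
    forwardEdges T rotated
      ≡⟨ forwardEdges≡∑ T rotated ⟩
    ∑∑ f
      ≡⟨ ∑-permute (λ p → ∑[ q < suc n ] f p q) ρ ⟩
    ∑[ x < suc n ] ∑[ q < suc n ] f (ρ ⟨$⟩ʳ x) q
      ≡⟨ sum-cong-≗ (λ x → ∑-permute (f (ρ ⟨$⟩ʳ x)) ρ) ⟩
    ∑∑ (λ x y → f (ρ ⟨$⟩ʳ x) (ρ ⟨$⟩ʳ y))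
      ≡⟨ sum-cong-≗ (λ x → sum-cong-≗ λ y →
           cong₂ (λ u w → indicator (adj T (σ ⟨$⟩ʳ u) (σ ⟨$⟩ʳ w) ∧ ⌊ rank x <? rank y ⌋)) (inverseˡ ρ {x}) (inverseˡ ρ {y})) ⟩
    ∑∑ forward-after ∎
    where
    open ≡-Reasoning
    f : Fin (suc n) → Fin (suc n) → ℕ
    f p q = indicator (adj T (σ ⟨$⟩ʳ (ρ ⟨$⟩ˡ p)) (σ ⟨$⟩ʳ (ρ ⟨$⟩ˡ q)) ∧ ⌊ p Fin.<? q ⌋)

  into-i out-of-i : ℕ
  into-i   = ∑[ x < suc n ] indicator (edge x i ∧ between x)
  out-of-i = ∑[ y < suc n ] indicator (edge i y ∧ between y)

  into-i≡∑∑ : ∑∑ into-term ≡ into-i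
  into-i≡∑∑ = sum-cong-≗ λ x → trans
    (count-supported i (λ y → edge x y ∧ ((y == i) ∧ between x)) λ y y≢i →
       trans (cong (λ b → edge x y ∧ (b ∧ between x)) (≢⇒==-false y≢i)) (∧-zeroʳ _))
    (cong (λ b → indicator (edge x i ∧ (b ∧ between x))) (==-refl i))

  out-of-i≡∑∑ : ∑∑ out-term ≡ out-of-i
  out-of-i≡∑∑ = trans (∑-comm out-term) (sum-cong-≗ λ y → trans
    (count-supported i (λ x → edge x y ∧ ((x == i) ∧ between y)) λ x x≢i →
       trans (cong (λ b → edge x y ∧ (b ∧ between y)) (≢⇒==-false x≢i)) (∧-zeroʳ _))
    (cong (λ b → indicator (edge i y ∧ (b ∧ between y))) (==-refl i)))

  balance : forwardEdges T σ + into-i ≡ forwardEdges T rotated + out-of-i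
  balance = begin
    forwardEdges T σ + into-i                      ≡⟨ cong₂ _+_ (forwardEdges≡∑ T σ) (sym into-i≡∑∑) ⟩
    ∑∑ forward-before + ∑∑ into-term               ≡⟨ ∑∑-distrib-+ forward-before into-term ⟨
    ∑∑ (λ x y → forward-before x y + into-term x y) ≡⟨ sum-cong-≗ (λ x → sum-cong-≗ λ y →
                                                         indicator-∧-cong (edge x y) ⌊ x Fin.<? y ⌋ ((y == i) ∧ between x)
                                                           ⌊ rank x <? rank y ⌋ ((x == i) ∧ between y)
                                                           (rotation-identity x y)) ⟩
    ∑∑ (λ x y → forward-after x y + out-term x y)   ≡⟨ ∑∑-distrib-+ forward-after out-term ⟩
    ∑∑ forward-after + ∑∑ out-term                 ≡⟨ cong₂ _+_ (sym forward-rotated) out-of-i≡∑∑ ⟩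
    forwardEdges T rotated + out-of-i              ∎
    where open ≡-Reasoning

  into≤out : IsMedianOrdering T σ → into-i ≤ out-of-i
  into≤out median = +-cancelˡ-≤ (forwardEdges T σ) _ _ (begin
    forwardEdges T σ + into-i        ≡⟨ balance ⟩
    forwardEdges T rotated + out-of-i ≤⟨ +-monoˡ-≤ out-of-i (median rotated) ⟩
    forwardEdges T σ + out-of-i      ∎)
    where open ≤-Reasoning

median-feedback : ∀ {n} (T : Tournament n) (σ : Ordering n) → IsMedianOrdering T σ →
  ∀ y J → pos σ y < J → J < n →
  count (λ v → adj T v y ∧ inRange (suc (pos σ y)) (suc J) (pos σ v)) ≤
  count (out-neighbours T y (λ v → inRange (suc (pos σ y)) (suc J) (pos σ v)))
median-feedback {suc n} T σ median y J y<J J<n = subst₂ _≤_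
  (sym (trans (count-by-position σ (λ x v → adj T v y ∧ inRange (suc (pos σ y)) (suc J) x))
              (sum-cong-≗ λ x → cong₂ (λ u J′ → indicator (adj T (σ ⟨$⟩ʳ x) u ∧ inRange (suc (pos σ y)) (suc J′) (toℕ x)))
                                       (sym (inverseʳ σ {y})) (sym (Fin.toℕ-fromℕ< J<n)))))
  (sym (trans (count-by-position σ (λ x v → adj T y v ∧ inRange (suc (pos σ y)) (suc J) x))
              (sum-cong-≗ λ x → cong₂ (λ u J′ → indicator (adj T u (σ ⟨$⟩ʳ x) ∧ inRange (suc (pos σ y)) (suc J′) (toℕ x)))
                                       (sym (inverseʳ σ {y})) (sym (Fin.toℕ-fromℕ< J<n)))))
  (Rotated.into≤out T σ (σ ⟨$⟩ˡ y) j (subst (pos σ y <_) (sym (Fin.toℕ-fromℕ< J<n)) y<J) median)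
  where
  j : Fin (suc n)
  j = fromℕ< J<n

median-out-degree : ∀ {n} (T : Tournament n) (σ : Ordering n) → IsMedianOrdering T σ →
  ∀ y hi → pos σ y < hi → hi ≤ n →
  count (λ v → inRange (suc (pos σ y)) hi (pos σ v)) ≤
  2 * count (out-neighbours T y (λ v → inRange (suc (pos σ y)) hi (pos σ v)))
median-out-degree {n} T σ median y (suc J) (s≤s y≤J) J<n with m≤n⇒m<n∨m≡n y≤J
... | inj₂ refl = subst (_≤ 2 * count (out-neighbours T y (λ v → inRange (suc J) (suc J) (pos σ v))))
                      (sym (trans (count-positions σ (suc J) (suc J) J<n) (n∸n≡0 (suc J)))) z≤n
... | inj₁ y<J = begin
  count R                                             ≡⟨ count-neighbours T y R ⟩
  count (out-neighbours T y R) + count (in-neighbours T y R)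
    ≤⟨ +-monoʳ-≤ (count (out-neighbours T y R)) (≤-trans (count-mono in⇒into) (median-feedback T σ median y J y<J J<n)) ⟩
  count (out-neighbours T y R) + count (out-neighbours T y R)
    ≡⟨ cong (count (out-neighbours T y R) +_) (+-identityʳ _) ⟨
  2 * count (out-neighbours T y R)                    ∎
  where
  open ≤-Reasoning
  R : Fin n → Bool
  R v = inRange (suc (pos σ y)) (suc J) (pos σ v)
  in⇒into : in-neighbours T y R ⊆ᵇ (λ v → adj T v y ∧ R v)
  in⇒into v h = cong₂ _∧_ (⟶-total T y≢v (not-injective (∧-conicalˡ _ (R v) h))) Rv
    where
    Rv : R v ≡ true
    Rv = ∧-conicalʳ (not (adj T y v)) (R v) h
    y≢v : y ≢ v
    y≢v refl = <-irrefl refl (isYes-sound (suc (pos σ y) ≤? pos σ y) (∧-conicalˡ _ _ Rv))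

-- Arithmetic

out-degree-arith : ∀ D m o f₁ f₂ → D ≤ m → 8 * f₁ ≤ m → 8 * f₂ ≤ m →
                   D + 2 * m ≤ 2 * (D + (o + (f₁ + f₂))) → m ≤ 4 * o
out-degree-arith D m o f₁ f₂ D≤m f₁-small f₂-small H = *-cancelˡ-≤ 2 (+-cancelˡ-≤ (4 * D + 6 * m) _ _ (begin
  4 * D + 6 * m + 2 * m                   ≡⟨ e₁ D m ⟩
  4 * (D + 2 * m)                         ≤⟨ *-monoʳ-≤ 4 H ⟩
  4 * (2 * (D + (o + (f₁ + f₂))))         ≡⟨ e₂ D o f₁ f₂ ⟩
  4 * D + 4 * D + 8 * o + 8 * f₁ + 8 * f₂ ≤⟨ +-mono-≤ (+-mono-≤ (+-monoˡ-≤ (8 * o) (+-monoʳ-≤ (4 * D) (*-monoʳ-≤ 4 D≤m)))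
                                                               f₁-small) f₂-small ⟩
  4 * D + 4 * m + 8 * o + m + m           ≡⟨ e₃ D m o ⟩
  4 * D + 6 * m + 2 * (4 * o)             ∎))
  where
  open ≤-Reasoning
  e₁ : ∀ D m → 4 * D + 6 * m + 2 * m ≡ 4 * (D + 2 * m)
  e₁ = solve-∀
  e₂ : ∀ D o f₁ f₂ → 4 * (2 * (D + (o + (f₁ + f₂)))) ≡ 4 * D + 4 * D + 8 * o + 8 * f₁ + 8 * f₂
  e₂ = solve-∀
  e₃ : ∀ D m o → 4 * D + 4 * m + 8 * o + m + m ≡ 4 * D + 6 * m + 2 * (4 * o)
  e₃ = solve-∀

double-counting-arith : ∀ k m z w → 1 ≤ k → w ≤ 2 * m →
                        m * (8 * k) ≤ 4 * (8 * k * z + (k ∸ 1) * w) → m ≤ 4 * k * z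
double-counting-arith (suc k) m z w _ w≤2m H = *-cancelˡ-≤ 8 (+-cancelˡ-≤ (8 * k * m) _ _ (begin
  8 * k * m + 8 * m                  ≡⟨ e₁ k m ⟩
  m * (8 * suc k)                    ≤⟨ H ⟩
  4 * (8 * suc k * z + k * w)        ≤⟨ *-monoʳ-≤ 4 (+-monoʳ-≤ (8 * suc k * z) (*-monoʳ-≤ k w≤2m)) ⟩
  4 * (8 * suc k * z + k * (2 * m))  ≡⟨ e₂ k m z ⟩
  8 * k * m + 8 * (4 * suc k * z)    ∎))
  where
  open ≤-Reasoning
  e₁ : ∀ k m → 8 * k * m + 8 * m ≡ m * (8 * suc k)
  e₁ = solve-∀
  e₂ : ∀ k m z → 4 * (8 * suc k * z + k * (2 * m)) ≡ 8 * k * m + 8 * (4 * suc k * z)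
  e₂ = solve-∀

8*k≤2^[4*k] : ∀ k → 8 * k ≤ 2 ^ (4 * k)
8*k≤2^[4*k] zero    = z≤n
8*k≤2^[4*k] (suc k) = begin
  8 * suc k                     ≡⟨ *-suc 8 k ⟩
  8 + 8 * k                     ≤⟨ +-mono-≤ (*-monoʳ-≤ 8 (m^n>0 2 (4 * k))) (8*k≤2^[4*k] k) ⟩
  8 * x + x                     ≤⟨ m≤m+n (8 * x + x) (7 * x) ⟩
  8 * x + x + 7 * x             ≡⟨ e x ⟩
  2 ^ (4 + 4 * k)               ≡⟨ cong (2 ^_) (*-suc 4 k) ⟨
  2 ^ (4 * suc k)               ∎
  where
  open ≤-Reasoning
  x : ℕ
  x = 2 ^ (4 * k)
  e : ∀ x → 8 * x + x + 7 * x ≡ 2 * (2 * (2 * (2 * x)))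
  e = solve-∀

part-size-arith : ∀ k m B → 1 ≤ k → 2 ^ (20 * k) ≤ m → m ≤ 4 * k * (2 ^ (8 * k) * (2 * B)) → 2 ^ (8 * k) ≤ B
part-size-arith k m B k≥1 m-large m-small = ≮⇒≥ λ B<P → <-irrefl refl (begin-strict
  X * B           <⟨ +-monoˡ-≤ (X * B) X≥1 ⟩
  X + X * B       ≡⟨ *-suc X B ⟨
  X * suc B       ≤⟨ *-monoʳ-≤ X B<P ⟩
  X * P           ≤⟨ *-monoˡ-≤ P (*-monoˡ-≤ P (8*k≤2^[4*k] k)) ⟩
  2 ^ (4 * k) * P * P ≡⟨ power ⟨
  2 ^ (20 * k)    ≤⟨ m-large ⟩
  m               ≤⟨ m-small ⟩
  4 * k * (P * (2 * B)) ≡⟨ e k P B ⟩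
  X * B           ∎)
  where
  open ≤-Reasoning
  P X : ℕ
  P = 2 ^ (8 * k)
  X = 8 * k * P
  X≥1 : 1 ≤ X
  X≥1 = *-mono-≤ (≤-trans k≥1 (m≤n*m k 8)) (m^n>0 2 (8 * k))
  power : 2 ^ (20 * k) ≡ 2 ^ (4 * k) * P * P
  power = begin-equality
    2 ^ (20 * k)                       ≡⟨ cong (2 ^_) (split k) ⟩
    2 ^ (4 * k + 8 * k + 8 * k)        ≡⟨ ^-distribˡ-+-* 2 (4 * k + 8 * k) (8 * k) ⟩
    2 ^ (4 * k + 8 * k) * P            ≡⟨ cong (_* P) (^-distribˡ-+-* 2 (4 * k) (8 * k)) ⟩
    2 ^ (4 * k) * P * P                ∎
    where
    split : ∀ k → 20 * k ≡ 4 * k + 8 * k + 8 * k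
    split = solve-∀
  e : ∀ k P B → 4 * k * (P * (2 * B)) ≡ 8 * k * P * B
  e = solve-∀

-- Blocks

blockᵇ : ∀ {n} → Ordering n → (a m i : ℕ) → Fin n → Bool
blockᵇ σ a m i v = inRange (a + (i ∸ 1) * m) (a + i * m) (pos σ v)

module Blocks {n} (T : Tournament n) (σ : Ordering n) (median : IsMedianOrdering T σ)
              (a m t : ℕ) (fits : a + t * m ≤ n) (F : Fin n → Bool)
              (sparse : ∀ i → 1 ≤ i → i ≤ t → 8 * count (λ v → F v ∧ blockᵇ σ a m i v) ≤ m) where

  in-block : ℕ → Fin n → Bool
  in-block = blockᵇ σ a m

  F-in : ℕ → Fin n → Bool
  F-in i v = F v ∧ in-block i v

  free : ℕ → Fin n → Bool
  free i v = in-block i v ∧ not (F v)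

  boundary : ℕ → ℕ
  boundary i = a + i * m

  boundary-suc : ∀ i → boundary (suc i) ≡ boundary i + m
  boundary-suc i = shift a m i
    where
    shift : ∀ a m i → a + suc i * m ≡ a + i * m + m
    shift = solve-∀

  boundary-suc-suc : ∀ i → boundary (2 + i) ≡ boundary i + 2 * m
  boundary-suc-suc i = shift a m i
    where
    shift : ∀ a m i → a + (2 + i) * m ≡ a + i * m + 2 * m
    shift = solve-∀

  boundary-mono : ∀ i → boundary i ≤ boundary (suc i)
  boundary-mono i = subst (boundary i ≤_) (sym (boundary-suc i)) (m≤m+n (boundary i) m)

  boundary≤n : ∀ i → i ≤ t → boundary i ≤ n
  boundary≤n i i≤t = ≤-trans (+-monoʳ-≤ a (*-monoˡ-≤ m i≤t)) fits

  next-two : ℕ → Fin n → Bool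
  next-two j₀ v = inRange (boundary (suc j₀)) (boundary (3 + j₀)) (pos σ v)

  -- For a vertex of block j₀+1 (blocks are numbered from 1): the two following blocks, minus F.
  ahead : ℕ → Fin n → Bool
  ahead j₀ v = not (F v) ∧ next-two j₀ v

  next-two-split : ∀ j₀ v → next-two j₀ v ≡ in-block (2 + j₀) v ∨ in-block (3 + j₀) v
  next-two-split j₀ v = inRange-split (boundary-mono (suc j₀)) (boundary-mono (2 + j₀)) (pos σ v)

  out-into-next-two : ∀ j₀ y → count (out-neighbours T y (next-two j₀)) ≤
    count (out-neighbours T y (ahead j₀)) + (count (F-in (2 + j₀)) + count (F-in (3 + j₀)))
  out-into-next-two j₀ y = begin
    count (out-neighbours T y (next-two j₀))
      ≡⟨ count-split F (out-neighbours T y (next-two j₀)) ⟩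
    count (λ v → F v ∧ out-neighbours T y (next-two j₀) v) + count (λ v → not (F v) ∧ out-neighbours T y (next-two j₀) v)
      ≤⟨ +-mono-≤ (≤-trans (count-mono in-F) (count-∨ (F-in (2 + j₀)) (F-in (3 + j₀))))
                  (≤-reflexive (count-cong {n} λ v → ∧-exchange (not (F v)) (adj T y v) (next-two j₀ v))) ⟩
    (count (F-in (2 + j₀)) + count (F-in (3 + j₀))) + count (out-neighbours T y (ahead j₀))
      ≡⟨ +-comm _ (count (out-neighbours T y (ahead j₀))) ⟩
    count (out-neighbours T y (ahead j₀)) + (count (F-in (2 + j₀)) + count (F-in (3 + j₀))) ∎
    where
    open ≤-Reasoning
    in-F : (λ v → F v ∧ out-neighbours T y (next-two j₀) v) ⊆ᵇ (λ v → F-in (2 + j₀) v ∨ F-in (3 + j₀) v)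
    in-F v h = trans (sym (∧-distribˡ-∨ (F v) (in-block (2 + j₀) v) (in-block (3 + j₀) v)))
      (cong₂ _∧_ (∧-conicalˡ _ _ h) (trans (sym (next-two-split j₀ v)) (∧-conicalʳ (adj T y v) (next-two j₀ v) (∧-conicalʳ (F v) _ h))))

  -- y has at least half of the positions between it and the end of block j₀+3 as out-neighbours;
  -- at most D of them lie in y's own block and few are in F.
  out-into-ahead : ∀ j₀ → 3 + j₀ ≤ t → ∀ y → in-block (suc j₀) y ≡ true →
                   m ≤ 4 * count (out-neighbours T y (ahead j₀))
  out-into-ahead j₀ 3+j₀≤t y y∈block =
    out-degree-arith D m o f₂ f₃ D≤m (sparse (2 + j₀) (s≤s z≤n) 2+j₀≤t) (sparse (3 + j₀) (s≤s z≤n) 3+j₀≤t)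
      (begin
        D + 2 * m                        ≡⟨ |R| ⟨
        count R                          ≤⟨ median-out-degree T σ median y h₃ (<-≤-trans p<h₁ h₁≤h₃) h₃≤n ⟩
        2 * count (out-neighbours T y R) ≤⟨ *-monoʳ-≤ 2 out-R ⟩
        2 * (D + (o + (f₂ + f₃)))        ∎)
    where
    open ≤-Reasoning
    2+j₀≤t : 2 + j₀ ≤ t
    2+j₀≤t = ≤-trans (n≤1+n _) 3+j₀≤t
    p h₁ h₃ D o f₂ f₃ : ℕ
    p  = pos σ y
    h₁ = boundary (suc j₀)
    h₃ = boundary (3 + j₀)
    D  = h₁ ∸ suc p
    o  = count (out-neighbours T y (ahead j₀))
    f₂ = count (F-in (2 + j₀))
    f₃ = count (F-in (3 + j₀))
    R Before : Fin n → Bool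
    R      v = inRange (suc p) h₃ (pos σ v)
    Before v = inRange (suc p) h₁ (pos σ v)
    p<h₁ : p < h₁
    p<h₁ = inRange-hi y∈block
    h₁≤h₃ : h₁ ≤ h₃
    h₁≤h₃ = ≤-trans (boundary-mono (suc j₀)) (boundary-mono (2 + j₀))
    h₃≤n : h₃ ≤ n
    h₃≤n = boundary≤n (3 + j₀) 3+j₀≤t
    |R| : count R ≡ D + 2 * m
    |R| = begin-equality
      count R              ≡⟨ count-positions σ (suc p) h₃ h₃≤n ⟩
      h₃ ∸ suc p           ≡⟨ cong (_∸ suc p) (boundary-suc-suc (suc j₀)) ⟩
      (h₁ + 2 * m) ∸ suc p ≡⟨ +-∸-comm (2 * m) p<h₁ ⟩
      D + 2 * m            ∎
    D≤m : D ≤ m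
    D≤m = begin
      h₁ ∸ suc p                      ≤⟨ ∸-monoʳ-≤ h₁ (≤-trans (inRange-lo {boundary j₀} {h₁} y∈block) (n≤1+n p)) ⟩
      h₁ ∸ boundary j₀                ≡⟨ cong (_∸ boundary j₀) (boundary-suc j₀) ⟩
      (boundary j₀ + m) ∸ boundary j₀ ≡⟨ m+n∸m≡n (boundary j₀) m ⟩
      m                               ∎
    out-R : count (out-neighbours T y R) ≤ D + (o + (f₂ + f₃))
    out-R = begin
      count (out-neighbours T y R)
        ≡⟨ count-cong {n} (λ v → trans (cong (adj T y v ∧_) (inRange-split p<h₁ h₁≤h₃ (pos σ v)))
                                       (∧-distribˡ-∨ (adj T y v) (Before v) (next-two j₀ v))) ⟩
      count (λ v → out-neighbours T y Before v ∨ out-neighbours T y (next-two j₀) v)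
        ≤⟨ count-∨ (out-neighbours T y Before) (out-neighbours T y (next-two j₀)) ⟩
      count (out-neighbours T y Before) + count (out-neighbours T y (next-two j₀))
        ≤⟨ +-mono-≤ (≤-trans (count-mono (out-neighbours-⊆ T y Before))
                              (≤-reflexive (count-positions σ (suc p) h₁ (≤-trans h₁≤h₃ h₃≤n))))
                    (out-into-next-two j₀ y) ⟩
      D + (o + (f₂ + f₃)) ∎

  count-ahead : ∀ j₀ → 3 + j₀ ≤ t → count (ahead j₀) ≤ 2 * m
  count-ahead j₀ 3+j₀≤t = begin
    count (ahead j₀)
      ≤⟨ count-mono (λ v → ∧-conicalʳ (not (F v)) _) ⟩
    count (next-two j₀)
      ≡⟨ count-positions σ _ _ (boundary≤n (3 + j₀) 3+j₀≤t) ⟩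
    boundary (3 + j₀) ∸ boundary (suc j₀)
      ≡⟨ cong (_∸ boundary (suc j₀)) (boundary-suc-suc (suc j₀)) ⟩
    (boundary (suc j₀) + 2 * m) ∸ boundary (suc j₀)
      ≡⟨ m+n∸m≡n (boundary (suc j₀)) (2 * m) ⟩
    2 * m ∎
    where open ≤-Reasoning

  half-in-one-block : ∀ j₀ (Z : Fin n → Bool) → Z ⊆ᵇ ahead j₀ →
    ∃₂ λ j′ B → (j′ ≡ suc j₀ + 1 ⊎ j′ ≡ suc j₀ + 2) × B ⊆ᵇ Z × B ⊆ᵇ free j′ × count Z ≤ 2 * count B
  half-in-one-block j₀ Z Z⊆ahead = pick (count Zb ≤? count Za)
    where
    Za Zb : Fin n → Bool
    Za z = in-block (2 + j₀) z ∧ Z z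
    Zb z = not (in-block (2 + j₀) z) ∧ Z z
    not-F : ∀ z → Z z ≡ true → not (F z) ≡ true
    not-F z = ∧-conicalˡ (not (F z)) _ ∘ Z⊆ahead z
    in-third : ∀ z → Zb z ≡ true → in-block (3 + j₀) z ≡ true
    in-third z h = other (in-block (2 + j₀) z)
      (trans (sym (next-two-split j₀ z)) (∧-conicalʳ (not (F z)) _ (Z⊆ahead z (∧-conicalʳ _ _ h))))
      (∧-conicalˡ _ (Z z) h)
      where
      other : ∀ a {b} → (a ∨ b) ≡ true → not a ≡ true → b ≡ true
      other false h _ = h
    pick : Dec (count Zb ≤ count Za) →
      ∃₂ λ j′ B → (j′ ≡ suc j₀ + 1 ⊎ j′ ≡ suc j₀ + 2) × B ⊆ᵇ Z × B ⊆ᵇ free j′ × count Z ≤ 2 * count B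
    pick (yes b≤a) = 2 + j₀ , Za , inj₁ (+-comm 1 (suc j₀)) , (λ z → ∧-conicalʳ (in-block (2 + j₀) z) (Z z)) ,
      (λ z h → cong₂ _∧_ (∧-conicalˡ _ (Z z) h) (not-F z (∧-conicalʳ _ _ h))) ,
      ≤-trans (≤-reflexive (count-split (in-block (2 + j₀)) Z)) (n≤m⇒m+n≤2*m b≤a)
    pick (no b≰a) = 3 + j₀ , Zb , inj₂ (+-comm 2 (suc j₀)) , (λ z → ∧-conicalʳ (not (in-block (2 + j₀) z)) (Z z)) ,
      (λ z h → cong₂ _∧_ (in-third z h) (not-F z (∧-conicalʳ _ _ h))) ,
      ≤-trans (≤-reflexive (trans (count-split (in-block (2 + j₀)) Z) (+-comm (count Za) (count Zb))))
              (n≤m⇒m+n≤2*m (<⇒≤ (≰⇒> b≰a)))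

  module _ (k : ℕ) (k≥1 : 1 ≤ k) (m-large : 2 ^ (20 * k) ≤ m) where

    popular : ℕ → (Fin n → Bool) → Fin n → Bool
    popular j₀ Y z = ahead j₀ z ∧ ⌊ k ≤? indegree T Y z ⌋

    many-popular : ∀ j₀ → 3 + j₀ ≤ t → ∀ Y → Y ⊆ᵇ in-block (suc j₀) → count Y ≡ 8 * k →
                   m ≤ 4 * k * count (popular j₀ Y)
    many-popular j₀ 3+j₀≤t Y Y⊆ |Y| =
      double-counting-arith k m (count (popular j₀ Y)) (count (ahead j₀)) k≥1 (count-ahead j₀ 3+j₀≤t) (begin
        m * (8 * k)
          ≡⟨ cong (m *_) |Y| ⟨
        m * count Y
          ≡⟨ *-distribˡ-sum m (indicator ∘ Y) ⟩
        ∑[ y < n ] (m * indicator (Y y))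
          ≤⟨ ∑-mono-≤ lower ⟩
        ∑[ y < n ] (4 * (indicator (Y y) * count (out-neighbours T y (ahead j₀))))
          ≡⟨ *-distribˡ-sum 4 (λ y → indicator (Y y) * count (out-neighbours T y (ahead j₀))) ⟨
        4 * ∑[ y < n ] (indicator (Y y) * count (out-neighbours T y (ahead j₀)))
          ≡⟨ cong (4 *_) (double-count T Y (ahead j₀)) ⟩
        4 * ∑[ z < n ] (indicator (ahead j₀ z) * indegree T Y z)
          ≤⟨ *-monoʳ-≤ 4 (∑-mono-≤ upper) ⟩
        4 * ∑[ z < n ] (8 * k * indicator (popular j₀ Y z) + (k ∸ 1) * indicator (ahead j₀ z))
          ≡⟨ cong (4 *_) (trans (∑-distrib-+ (λ z → 8 * k * indicator (popular j₀ Y z)) (λ z → (k ∸ 1) * indicator (ahead j₀ z)))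
                                (cong₂ _+_ (sym (*-distribˡ-sum (8 * k) (indicator ∘ popular j₀ Y)))
                                           (sym (*-distribˡ-sum (k ∸ 1) (indicator ∘ ahead j₀))))) ⟩
        4 * (8 * k * count (popular j₀ Y) + (k ∸ 1) * count (ahead j₀)) ∎)
      where
      open ≤-Reasoning
      lower : ∀ y → m * indicator (Y y) ≤ 4 * (indicator (Y y) * count (out-neighbours T y (ahead j₀)))
      lower y with Y y in Yy
      ... | false = ≤-reflexive (*-zeroʳ m)
      ... | true  = begin
        m * 1                                         ≡⟨ *-identityʳ m ⟩
        m                                             ≤⟨ out-into-ahead j₀ 3+j₀≤t y (Y⊆ y Yy) ⟩
        4 * count (out-neighbours T y (ahead j₀))     ≡⟨ cong (4 *_) (*-identityˡ (count (out-neighbours T y (ahead j₀)))) ⟨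
        4 * (1 * count (out-neighbours T y (ahead j₀))) ∎
      upper : ∀ z → indicator (ahead j₀ z) * indegree T Y z ≤
                    8 * k * indicator (popular j₀ Y z) + (k ∸ 1) * indicator (ahead j₀ z)
      upper z with ahead j₀ z
      ... | false = z≤n
      ... | true with k ≤? indegree T Y z
      ...   | yes _ = begin
        1 * indegree T Y z                ≡⟨ *-identityˡ _ ⟩
        indegree T Y z                    ≤⟨ subst (indegree T Y z ≤_) |Y| (indegree-≤ T Y z) ⟩
        8 * k                             ≡⟨ *-identityʳ (8 * k) ⟨
        8 * k * 1                         ≤⟨ m≤m+n (8 * k * 1) ((k ∸ 1) * 1) ⟩
        8 * k * 1 + (k ∸ 1) * 1           ∎
      ...   | no k≰d = begin
        1 * indegree T Y z                ≡⟨ *-identityˡ _ ⟩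
        indegree T Y z                    ≤⟨ subst (indegree T Y z ≤_) (pred[m∸n]≡m∸[1+n] k 0) (<⇒≤pred (≰⇒> k≰d)) ⟩
        k ∸ 1                             ≡⟨ *-identityʳ (k ∸ 1) ⟨
        (k ∸ 1) * 1                       ≡⟨ cong (_+ (k ∸ 1) * 1) (*-zeroʳ (8 * k)) ⟨
        8 * k * 0 + (k ∸ 1) * 1           ∎

    record Successor (j : ℕ) (Y : Fin n → Bool) : Set where
      field
        next       : ℕ
        next-step  : next ≡ j + 1 ⊎ next ≡ j + 2
        kept       : Fin n → Bool
        kept⊆Y     : kept ⊆ᵇ Y
        |kept|     : count kept ≡ k
        fresh      : Fin n → Bool
        fresh⊆     : fresh ⊆ᵇ free next
        |fresh|    : count fresh ≡ 8 * k
        fresh-transitive : TransitiveOn T fresh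
        kept⇒fresh : kept ⇒ᵇ[ T ] fresh

    successor : ∀ j₀ → 3 + j₀ ≤ t → ∀ Y → Y ⊆ᵇ free (suc j₀) → count Y ≡ 8 * k → Successor (suc j₀) Y
    successor j₀ 3+j₀≤t Y Y⊆ |Y|
      with common-out-neighbourhood T (8 * k) Y |Y| k (m≤n*m k 8) (popular j₀ Y)
             (λ z h → isYes-sound (k ≤? indegree T Y z) (∧-conicalʳ (ahead j₀ z) _ h))
    ... | kept , Z , kept⊆Y , |kept| , Z⊆popular , kept⇒Z , |popular|≤ =
      let j′ , B , j′-step , B⊆Z , B⊆block , Z≤2B = half-in-one-block j₀ Z (λ z → ∧-conicalˡ _ _ ∘ Z⊆popular z)
          fresh , fresh⊆B , |fresh| , fresh-tr = erdős-moser T (8 * k) B (part-size-arith k m (count B) k≥1 m-large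
            (≤-trans (many-popular j₀ 3+j₀≤t Y (λ y → ∧-conicalˡ _ _ ∘ Y⊆ y) |Y|)
                     (*-monoʳ-≤ (4 * k) (≤-trans |popular|≤ (*-monoʳ-≤ (2 ^ (8 * k)) Z≤2B)))))
      in record
        { next = j′ ; next-step = j′-step ; kept = kept ; kept⊆Y = kept⊆Y ; |kept| = |kept|
        ; fresh = fresh ; fresh⊆ = λ z → B⊆block z ∘ fresh⊆B z ; |fresh| = |fresh| ; fresh-transitive = fresh-tr
        ; kept⇒fresh = λ y z hy hz → kept⇒Z y z hy (B⊆Z z (fresh⊆B z hz))
        }

    record Chain (j : ℕ) (Y : Fin n → Bool) : Set where
      field
        s     : ℕ
        Xs    : ℕ → Fin n → Bool
        js    : ℕ → ℕ
        1≤s   : 1 ≤ s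
        X₀⊆Y  : Xs 0 ⊆ᵇ Y
        js₀   : js 0 ≡ j
        steps : ∀ i → suc i < s → js (suc i) ≡ js i + 1 ⊎ js (suc i) ≡ js i + 2
        last  : js (s ∸ 1) ≡ t ∸ 1 ⊎ js (s ∸ 1) ≡ t
        parts : ∀ i → i < s → Xs i ⊆ᵇ free (js i) × count (Xs i) ≡ k × InducesTransitiveᵇ T (Xs i)
        links : ∀ i → suc i < s → Xs i ⇒ᵇ[ T ] Xs (suc i)

    chain-single : ∀ {j Y} → t ≤ suc j → j ≤ t →
                   Y ⊆ᵇ free j → count Y ≡ 8 * k → InducesTransitiveᵇ T Y → Chain j Y
    chain-single {j} {Y} t≤j+1 j≤t Y⊆ |Y| trY =
      let X , X⊆Y , |X| = subset-of-size Y k (subst (k ≤_) (sym |Y|) (m≤n*m k 8)) in record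
        { s = 1 ; Xs = λ _ → X ; js = λ _ → j ; 1≤s = ≤-refl ; X₀⊆Y = X⊆Y ; js₀ = refl
        ; steps = λ _ → λ { (s≤s ()) }
        ; last  = last-block
        ; parts = λ { zero _ → (λ v → Y⊆ v ∘ X⊆Y v) , |X| , ranked-⊆ T X⊆Y trY ; (suc _) (s≤s ()) }
        ; links = λ _ → λ { (s≤s ()) }
        }
      where
      last-block : j ≡ t ∸ 1 ⊎ j ≡ t
      last-block with m≤n⇒m<n∨m≡n j≤t
      ... | inj₂ j≡t = inj₂ j≡t
      ... | inj₁ j<t = inj₁ (cong (_∸ 1) (≤-antisym j<t t≤j+1))

    chain-cons : ∀ {j Y} → Y ⊆ᵇ free j → InducesTransitiveᵇ T Y → (S : Successor j Y) →
                 Chain (Successor.next S) (Successor.fresh S) → Chain j Y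
    chain-cons {j} {Y} Y⊆ trY S C = record
      { s = suc s ; Xs = Xs′ ; js = js′ ; 1≤s = s≤s z≤n ; X₀⊆Y = kept⊆Y ; js₀ = refl
      ; steps = steps′ ; last = last′ s 1≤s last ; parts = parts′ ; links = links′
      }
      where
      open Successor S
      open Chain C
      Xs′ : ℕ → Fin n → Bool
      Xs′ zero    = kept
      Xs′ (suc i) = Xs i
      js′ : ℕ → ℕ
      js′ zero    = j
      js′ (suc i) = js i
      steps′ : ∀ i → suc i < suc s → js′ (suc i) ≡ js′ i + 1 ⊎ js′ (suc i) ≡ js′ i + 2
      steps′ zero    _       = subst (λ j′ → j′ ≡ j + 1 ⊎ j′ ≡ j + 2) (sym js₀) next-step
      steps′ (suc i) (s≤s h) = steps i h
      last′ : ∀ r → 1 ≤ r → js (r ∸ 1) ≡ t ∸ 1 ⊎ js (r ∸ 1) ≡ t → js′ r ≡ t ∸ 1 ⊎ js′ r ≡ t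
      last′ (suc r) _ h = h
      parts′ : ∀ i → i < suc s → Xs′ i ⊆ᵇ free (js′ i) × count (Xs′ i) ≡ k × InducesTransitiveᵇ T (Xs′ i)
      parts′ zero    _       = (λ v → Y⊆ v ∘ kept⊆Y v) , |kept| , ranked-⊆ T kept⊆Y trY
      parts′ (suc i) (s≤s h) = parts i h
      links′ : ∀ i → suc i < suc s → Xs′ i ⇒ᵇ[ T ] Xs′ (suc i)
      links′ zero    _       y z hy hz = kept⇒fresh y z hy (X₀⊆Y z hz)
      links′ (suc i) (s≤s h) = links i h

    chain : ∀ d j → t ≤ j + d → 1 ≤ j → j ≤ t →
            ∀ Y → Y ⊆ᵇ free j → count Y ≡ 8 * k → InducesTransitiveᵇ T Y → Chain j Y
    chain d (suc j₀) t≤j+d _ j≤t Y Y⊆ |Y| trY with 3 + j₀ ≤? t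
    ... | no j+2≰t = chain-single (≤-pred (≰⇒> j+2≰t)) j≤t Y⊆ |Y| trY
    chain zero (suc j₀) t≤j+0 _ _ _ _ _ _ | yes j+2≤t =
      ⊥-elim (1+n≰n (≤-trans (n≤1+n _) (≤-trans j+2≤t (≤-trans t≤j+0 (≤-reflexive (+-identityʳ (suc j₀)))))))
    chain (suc d) (suc j₀) t≤j+d _ _ Y Y⊆ |Y| trY | yes j+2≤t =
      chain-cons Y⊆ trY S (chain d next t≤next+d (≤-trans (s≤s z≤n) next≥j+1) next≤t fresh fresh⊆ |fresh|
                                 (transitive⇒ranked T fresh-transitive))
      where
      S : Successor (suc j₀) Y
      S = successor j₀ j+2≤t Y Y⊆ |Y|
      open Successor S
      next≥j+1 : suc j₀ + 1 ≤ next
      next≥j+1 = [ ≤-reflexive ∘ sym , (λ e → ≤-trans (+-monoʳ-≤ (suc j₀) (n≤1+n 1)) (≤-reflexive (sym e))) ]′ next-step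
      next≤t : next ≤ t
      next≤t = [ (λ e → ≤-trans (≤-reflexive e) (≤-trans (≤-reflexive (+-comm (suc j₀) 1)) (≤-trans (n≤1+n _) j+2≤t))) ,
                 (λ e → ≤-trans (≤-reflexive e) (≤-trans (≤-reflexive (+-comm (suc j₀) 2)) j+2≤t)) ]′ next-step
      t≤next+d : t ≤ next + d
      t≤next+d = ≤-trans t≤j+d (≤-trans (≤-reflexive (shift j₀ d)) (+-monoˡ-≤ d next≥j+1))
        where
        shift : ∀ j d → suc j + suc d ≡ (suc j + 1) + d
        shift = solve-∀

-- Subsets

∣∣≡count : ∀ {n} (p : Subset n) → ∣ p ∣ ≡ count (lookup p)
∣∣≡count []          = refl
∣∣≡count (true ∷ p)  = cong suc (∣∣≡count p)
∣∣≡count (false ∷ p) = ∣∣≡count p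

∈⇒lookup : ∀ {n} {v : Fin n} {p : Subset n} → v ∈ p → lookup p v ≡ true
∈⇒lookup = []=⇒lookup

lookup⇒∈ : ∀ {n} {v : Fin n} {p : Subset n} → lookup p v ≡ true → v ∈ p
lookup⇒∈ {v = v} {p} = lookup⇒[]= v p

∈-tabulate⁻ : ∀ {n} {P : Fin n → Bool} {v} → v ∈ tabulate P → P v ≡ true
∈-tabulate⁻ {P = P} {v} v∈ = trans (sym (lookup∘tabulate P v)) (∈⇒lookup v∈)

lookup-─ : ∀ {n} (p q : Subset n) v → lookup (p ─ q) v ≡ lookup p v ∧ not (lookup q v)
lookup-─ (x ∷ p) (true  ∷ q) zero    = sym (∧-zeroʳ x)
lookup-─ (x ∷ p) (false ∷ q) zero    = sym (∧-identityʳ x)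
lookup-─ (x ∷ p) (y     ∷ q) (suc v) = lookup-─ p q v

∣tabulate∣ : ∀ {n} (P : Fin n → Bool) → ∣ tabulate P ∣ ≡ count P
∣tabulate∣ P = trans (∣∣≡count (tabulate P)) (count-cong (lookup∘tabulate P))

tabulate-⊆ : ∀ {n} {P : Fin n → Bool} {q : Subset n} → P ⊆ᵇ lookup q → tabulate P ⊆ q
tabulate-⊆ P⊆q v∈ = lookup⇒∈ (P⊆q _ (∈-tabulate⁻ v∈))

lookup-∩-block : ∀ {n} (σ : Ordering n) a m i (F : Subset n) v →
                 lookup (F ∩ block σ a m i) v ≡ lookup F v ∧ blockᵇ σ a m i v
lookup-∩-block σ a m i F v = trans (lookup-zipWith _∧_ v F (block σ a m i)) (cong (lookup F v ∧_) (lookup∘tabulate _ v))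

lookup-block-─ : ∀ {n} (σ : Ordering n) a m i (F : Subset n) v →
                 lookup (block σ a m i ─ F) v ≡ blockᵇ σ a m i v ∧ not (lookup F v)
lookup-block-─ σ a m i F v = trans (lookup-─ (block σ a m i) F v) (cong (_∧ not (lookup F v)) (lookup∘tabulate _ v))

module _ {n : ℕ} (T : Tournament n) where

  lookup-ranked : (X : Subset n) → InducesTransitive T X → InducesTransitiveᵇ T (lookup X)
  lookup-ranked X (r , increasing) = r , λ u v Xu Xv → increasing u v (lookup⇒∈ Xu) (lookup⇒∈ Xv)

  tabulate-ranked : (P : Fin n → Bool) → InducesTransitiveᵇ T P → InducesTransitive T (tabulate P)
  tabulate-ranked P (r , increasing) = r , λ u v u∈ v∈ → increasing u v (∈-tabulate⁻ u∈) (∈-tabulate⁻ v∈)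

  tabulate-⇒ : (P Q : Fin n → Bool) → P ⇒ᵇ[ T ] Q → tabulate P ⇒[ T ] tabulate Q
  tabulate-⇒ P Q P⇒Q = (λ v v∈P v∈Q → ⟶-irrefl T (P⇒Q v v (∈-tabulate⁻ v∈P) (∈-tabulate⁻ v∈Q))) ,
                       λ u v u∈ v∈ → P⇒Q u v (∈-tabulate⁻ u∈) (∈-tabulate⁻ v∈)

lemma2p9 : (k : ℕ) → 0 < k →
    (n : ℕ) (T : Tournament n) (σ : Ordering n) → IsMedianOrdering T σ →
    (a m t : ℕ) → 1 ≤ t → a + t * m ≤ n → 2 ^ (20 * k) ≤ m →
    (F : Subset n) →
    (∀ i → 1 ≤ i → i ≤ t → 8 * ∣ F ∩ block σ a m i ∣ ≤ m) →
    (X : Subset n) → X ⊆ (block σ a m 1 ─ F) → ∣ X ∣ ≡ 8 * k →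
    InducesTransitive T X →
    Σ ℕ λ s → Σ (ℕ → Subset n) λ Xs → Σ (ℕ → ℕ) λ j →
      1 ≤ s ×
      Xs 0 ⊆ X ×
      j 0 ≡ 1 ×
      (∀ i → suc i < s → (j (suc i) ≡ j i + 1 ⊎ j (suc i) ≡ j i + 2)) ×
      (j (s ∸ 1) ≡ t ∸ 1 ⊎ j (s ∸ 1) ≡ t) ×
      (∀ i → i < s →
        Xs i ⊆ (block σ a m (j i) ─ F) × ∣ Xs i ∣ ≡ k × InducesTransitive T (Xs i)) ×
      (∀ i → suc i < s → Xs i ⇒[ T ] Xs (suc i))
lemma2p9 k k≥1 n T σ median a m t t≥1 fits m-large F F-sparse X X⊆ |X| X-ranked =
  s , tabulate ∘ Xs , js , 1≤s , tabulate-⊆ X₀⊆Y , js₀ , steps , last ,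
  (λ i i<s → let Xᵢ⊆ , |Xᵢ| , Xᵢ-ranked = parts i i<s in
     tabulate-⊆ (λ v → trans (lookup-block-─ σ a m (js i) F v) ∘ Xᵢ⊆ v) ,
     trans (∣tabulate∣ (Xs i)) |Xᵢ| , tabulate-ranked T (Xs i) Xᵢ-ranked) ,
  (λ i i<s → tabulate-⇒ T (Xs i) (Xs (suc i)) (links i i<s))
  where
  sparse : ∀ i → 1 ≤ i → i ≤ t → 8 * count (λ v → lookup F v ∧ blockᵇ σ a m i v) ≤ m
  sparse i 1≤i i≤t = subst (λ c → 8 * c ≤ m)
    (trans (∣∣≡count (F ∩ block σ a m i)) (count-cong (lookup-∩-block σ a m i F))) (F-sparse i 1≤i i≤t)
  open Blocks T σ median a m t fits (lookup F) sparse
  X⊆free : lookup X ⊆ᵇ free 1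
  X⊆free v Xv = trans (sym (lookup-block-─ σ a m 1 F v)) (∈⇒lookup (X⊆ (lookup⇒∈ Xv)))
  open Chain (chain k k≥1 m-large t 1 (n≤1+n t) ≤-refl t≥1 (lookup X) X⊆free
                    (trans (sym (∣∣≡count X)) |X|) (lookup-ranked T X X-ranked))
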